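{- Let $q\ge2$, $n\ge1$, and let $\mathbf{a}=(A_0,\dots,A_n)$ be a quasicode of length $n$ over an alphabet of size $q$ whose support is $\{a_1<a_2<\dots<a_s\}$. Suppose $\mathbf{a}$ is a $(2s-1)$-design. Then $h(x)=(a_1-x)(a_2-x)\cdots(a_s-x)$, as a function on $\{0,\dots,n\}$, is positive definite.
   Context: Krawtchouk polynomials: $K_k(x)=\sum_{j=0}^k(-1)^j(q-1)^{k-j}\binom{x}{j}\binom{n-x}{k-j}$. A quasicode of length $n$ and size $N$ is a real vector $(A_0,\dots,A_n)$ with $A_0=1$, $A_i\ge0$, $\sum_iA_i=N$, and $\sum_{i=0}^nA_iK_j(i)\ge0$ for $j=0,\dots,n$. Its dual has entries $A^\perp_j=\frac1N\sum_iA_iK_j(i)$; $\mathbf{a}$ is a $t$-design if $A^\perp_j=0$ for $1\le j\le t$. The support is $\{i\ge1:A_i\ne0\}$. A function $h\colon\{0,\dots,n\}\to\mathbb{R}$ is positive definite if the unique reals $c_0,\dots,c_n$ with $h(i)=\sum_{j=0}^nc_jK_j(i)$ for $i=0,\dots,n$ are all nonnegative. -}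

module Defs where

open import Level using (Level; _⊔_) renaming (suc to lsuc)
open import Algebra.Bundles using (CommutativeRing)
open import Relation.Binary.Core using (Rel)
open import Relation.Binary.Structures using (IsTotalOrder)
open import Relation.Nullary using (¬_)
open import Data.Nat as ℕ using (ℕ; zero; suc; _∸_)
open import Data.Nat.Combinatorics using (_C_)
open import Data.Integer as ℤ using (ℤ; +_; -[1+_])
open import Data.Fin as Fin using (Fin)
open import Data.Product using (Σ; ∃; _×_; _,_)
open import Function.Bundles using (_⇔_)

-- Krawtchouk polynomial K_k(x) for alphabet size q and length n, as an integer:
-- K_k(x) = Σ_{j=0}^{k} (-1)^j (q-1)^{k-j} C(x,j) C(n-x,k-j).
-- (Data.Nat.Combinatorics._C_ is 0 when the lower index exceeds the upper one.)
sumℤ : (ℕ → ℤ) → ℕ → ℤ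
sumℤ f zero    = + 0
sumℤ f (suc m) = sumℤ f m ℤ.+ f m

signℤ : ℕ → ℤ
signℤ zero          = + 1
signℤ (suc zero)    = -[1+ 0 ]
signℤ (suc (suc j)) = signℤ j

Krawtchouk : (q n k x : ℕ) → ℤ
Krawtchouk q n k x =
  sumℤ (λ j → signℤ j ℤ.* (+ ((q ∸ 1) ℕ.^ (k ∸ j) ℕ.* (x C j) ℕ.* ((n ∸ x) C (k ∸ j))))) (suc k)

-- An ordered field (the reals are an instance). _⁻¹ is total; its value at 0 is irrelevant.
record OrderedField (c ℓ₁ ℓ₂ : Level) : Set (lsuc (c ⊔ ℓ₁ ⊔ ℓ₂)) where
  field
    commutativeRing : CommutativeRing c ℓ₁
  open CommutativeRing commutativeRing public
  field
    _≤_          : Rel Carrier ℓ₂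
    isTotalOrder : IsTotalOrder _≈_ _≤_
    +-monoˡ-≤    : ∀ {x y} z → x ≤ y → (x + z) ≤ (y + z)
    *-nonneg     : ∀ {x y} → 0# ≤ x → 0# ≤ y → 0# ≤ (x * y)
    0≉1          : ¬ (0# ≈ 1#)
    _⁻¹          : Carrier → Carrier
    ⁻¹-inverse   : ∀ x → ¬ (x ≈ 0#) → (x * (x ⁻¹)) ≈ 1#

module OverField {c ℓ₁ ℓ₂} (F : OrderedField c ℓ₁ ℓ₂) where
  open OrderedField F

  fromℕ : ℕ → Carrier
  fromℕ zero    = 0#
  fromℕ (suc m) = 1# + fromℕ m

  fromℤ : ℤ → Carrier
  fromℤ (+ m)     = fromℕ m
  fromℤ -[1+ m ]  = - (1# + fromℕ m)

  Σ< : (ℕ → Carrier) → ℕ → Carrier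
  Σ< f zero    = 0#
  Σ< f (suc m) = Σ< f m + f m

  Π : ∀ {s} → (Fin s → Carrier) → Carrier
  Π {zero}  f = 1#
  Π {suc s} f = f Fin.zero * Π (λ k → f (Fin.suc k))

  K : (q n k x : ℕ) → Carrier
  K q n k x = fromℤ (Krawtchouk q n k x)

  -- A : ℕ → Carrier represents (A_0,...,A_n); values at indices > n are ignored.
  record IsQuasicode (q n : ℕ) (A : ℕ → Carrier) (N : Carrier) : Set (c ⊔ ℓ₁ ⊔ ℓ₂) where
    field
      A₀≈1    : A 0 ≈ 1#
      nonneg  : ∀ i → i ℕ.≤ n → 0# ≤ A i
      size    : Σ< A (suc n) ≈ N
      dualNonneg : ∀ j → j ℕ.≤ n → 0# ≤ Σ< (λ i → A i * K q n j i) (suc n)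

  dual : (q n : ℕ) → (ℕ → Carrier) → Carrier → ℕ → Carrier
  dual q n A N j = (N ⁻¹) * Σ< (λ i → A i * K q n j i) (suc n)

  IsDesign : (q n : ℕ) → (ℕ → Carrier) → Carrier → ℕ → Set ℓ₁
  IsDesign q n A N t = ∀ j → 1 ℕ.≤ j → j ℕ.≤ t → j ℕ.≤ n → dual q n A N j ≈ 0#

  StrictlyIncreasing : ∀ {s} → (Fin s → ℕ) → Set
  StrictlyIncreasing a = ∀ k l → k Fin.< l → a k ℕ.< a l

  IsSupport : ∀ {s} → ℕ → (ℕ → Carrier) → (Fin s → ℕ) → Set ℓ₁
  IsSupport n A a = ∀ i → ((1 ℕ.≤ i × i ℕ.≤ n × ¬ (A i ≈ 0#)) ⇔ ∃ λ k → a k ≡ i)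
    where open import Relation.Binary.PropositionalEquality using (_≡_)

  h : ∀ {s} → (Fin s → ℕ) → ℕ → Carrier
  h a x = Π (λ k → fromℕ (a k) - fromℕ x)

  IsKExpansion : (q n : ℕ) → (ℕ → Carrier) → (ℕ → Carrier) → Set ℓ₁
  IsKExpansion q n f cs = ∀ i → i ℕ.≤ n → f i ≈ Σ< (λ j → cs j * K q n j i) (suc n)

  PositiveDefinite : (q n : ℕ) → (ℕ → Carrier) → Set (c ⊔ ℓ₁ ⊔ ℓ₂)
  PositiveDefinite q n f =
    (Σ (ℕ → Carrier) λ cs → IsKExpansion q n f cs)
    × (∀ cs → IsKExpansion q n f cs → ∀ j → j ℕ.≤ n → 0# ≤ cs j)

module Submission where

-- With q = u + 1, the Krawtchouk polynomials K_k are orthogonal for the weights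
-- w_i = C(n,i) u^i; we work in an arbitrary ordered field F.
-- * Binomial, OverOrderedField: binomial identities; casts ℕ, ℤ → F; sums.
-- * ConvolutionRecurrence, Krawtchouk: K_k is a convolution of two binomial
--   rows, hence q x K_k = α K_{k+1} + β K_k + γ K_{k-1}; reciprocity
--   w_i K_k(i) = w_k K_i(k); column sums Σ_k K_k(x) = 0 for x ≥ 1.
-- * Orthogonality: these give ⟨K_0,K_l⟩ = 0, self-adjointness of x spreads it
--   to all j ≠ l, and ⟨K_j,K_j⟩ ≠ 0, so K-coefficients are ⟨f,K_l⟩/⟨K_l,K_l⟩.
-- * KExpansion: a factor (a - x) raises the K-degree by one and keeps the top
--   coefficient ≥ 0, so h = Π_k (a_k - x) has degree s and h K_j degree s + j.
-- * Quasicode: a t-design sums g of degree ≤ t to N ĝ₀.  For j < s, h K_j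
--   vanishes on the support, so N ĝ₀ = A_0 h(0) K_j(0) ≥ 0 and hence
--   ⟨h,K_j⟩ = ĝ₀ ⟨K_0,K_0⟩ ≥ 0; for j ≥ s the coefficient is the top one or 0.
--   Vanishing on the support is only known up to ¬¬ (F is not decidable);
--   this suffices because ⟨h,K_j⟩ is an integer, whose sign is decidable.

open import Level using (_⊔_)
open import Defs
open import Relation.Binary.Structures using (IsTotalOrder)
open import Data.Nat as ℕ using (ℕ; zero; suc; z≤n; s≤s; _!)
import Data.Nat.Properties as ℕP
open import Data.Nat.Combinatorics
  using (_C_; k>n⇒nCk≡0; nCk+nC[k+1]≡[n+1]C[k+1]; nCk≡n!/k![n-k]!; k![n∸k]!∣n!; nCk≡nC[n∸k])
open import Data.Nat.DivMod using (m/n*n≡m)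
open import Data.Nat.Solver using (module +-*-Solver)
open import Data.Integer as ℤ using (ℤ; +_; -[1+_])
import Data.Integer.Properties as ℤP
import Data.Sign as Sg
open import Data.Fin using (Fin) renaming (zero to fzero; suc to fsuc)
open import Data.Fin.Properties using (any?)
open import Data.Product using (_,_; ∃; proj₁; proj₂)
open import Data.Sum using (inj₁; inj₂)
open import Data.Empty using (⊥-elim)
open import Relation.Nullary using (¬_; yes; no)
open import Relation.Binary.PropositionalEquality as P using (_≡_)
open import Relation.Binary.Definitions using (tri<; tri≈; tri>)
open import Function.Bundles using (module Equivalence)

-- Identities between binomial coefficients over ℕ.
module Binomial where
  open ℕP
  open P using (refl; sym; trans; cong; cong₂)
  open +-*-Solver using (solve; _:=_; _:+_; _:*_; con)

  C*factorials : ∀ {n k} → k ℕ.≤ n → (n C k) ℕ.* (k ! ℕ.* (n ℕ.∸ k) !) ≡ n !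
  C*factorials {n} {k} k≤n =
    trans (cong (ℕ._* (k ! ℕ.* (n ℕ.∸ k) !)) (nCk≡n!/k![n-k]! k≤n))
          (m/n*n≡m {{k !* (n ℕ.∸ k) !≢0}} (k![n∸k]!∣n! k≤n))

  C-absorb : ∀ x j → suc j ℕ.* (x C suc j) ≡ (x ℕ.∸ j) ℕ.* (x C j)
  C-absorb x j with <-≤-connex j x
  ... | inj₂ x≤j = trans (cong (suc j ℕ.*_) (k>n⇒nCk≡0 (s≤s x≤j)))
                         (trans (*-zeroʳ (suc j)) (sym (cong (ℕ._* (x C j)) (m≤n⇒m∸n≡0 x≤j))))
  ... | inj₁ j<x = *-cancelʳ-≡ _ _ (j ! ℕ.* r !) {{j !* r !≢0}} (trans lhs (sym rhs))
    where
    r : ℕ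
    r = x ℕ.∸ suc j
    x∸j≡1+r : x ℕ.∸ j ≡ suc r
    x∸j≡1+r = +-∸-assoc 1 j<x
    lhs : suc j ℕ.* (x C suc j) ℕ.* (j ! ℕ.* r !) ≡ x !
    lhs = trans (solve 4 (λ J X F R → (con 1 :+ J) :* X :* (F :* R) := X :* ((con 1 :+ J) :* F :* R))
                  refl j (x C suc j) (j !) (r !))
                (C*factorials j<x)
    rhs : (x ℕ.∸ j) ℕ.* (x C j) ℕ.* (j ! ℕ.* r !) ≡ x !
    rhs = trans (cong (λ z → z ℕ.* (x C j) ℕ.* (j ! ℕ.* r !)) x∸j≡1+r)
          (trans (solve 4 (λ R X F G → (con 1 :+ R) :* X :* (F :* G) := X :* (F :* ((con 1 :+ R) :* G)))
                   refl r (x C j) (j !) (r !))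
          (trans (cong (λ z → (x C j) ℕ.* (j ! ℕ.* z !)) (sym x∸j≡1+r)) (C*factorials (<⇒≤ j<x))))

  ∸-∸-cancel : ∀ n {j i} → j ℕ.≤ i → (n ℕ.∸ j) ℕ.∸ (i ℕ.∸ j) ≡ n ℕ.∸ i
  ∸-∸-cancel n {j} {i} j≤i = trans (∸-+-assoc n j (i ℕ.∸ j)) (cong (n ℕ.∸_) (m+[n∸m]≡n j≤i))

  C-subset : ∀ n i j → j ℕ.≤ i → (n C i) ℕ.* (i C j) ≡ (n C j) ℕ.* ((n ℕ.∸ j) C (i ℕ.∸ j))
  C-subset n i j j≤i with <-≤-connex n i
  ... | inj₁ n<i = trans (cong (ℕ._* (i C j)) (k>n⇒nCk≡0 n<i)) (sym rhs≡0)
    where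
    rhs≡0 : (n C j) ℕ.* ((n ℕ.∸ j) C (i ℕ.∸ j)) ≡ 0
    rhs≡0 with <-≤-connex n j
    ... | inj₁ n<j = cong (ℕ._* ((n ℕ.∸ j) C (i ℕ.∸ j))) (k>n⇒nCk≡0 n<j)
    ... | inj₂ j≤n = trans (cong ((n C j) ℕ.*_) (k>n⇒nCk≡0 (∸-monoˡ-< n<i j≤n))) (*-zeroʳ (n C j))
  ... | inj₂ i≤n = *-cancelʳ-≡ _ _ M {{M≢0}} (trans lhs (sym rhs))
    where
    M : ℕ
    M = j ! ℕ.* ((i ℕ.∸ j) ! ℕ.* (n ℕ.∸ i) !)
    M≢0 : ℕ.NonZero M
    M≢0 = m*n≢0 _ _ {{j !≢0}} {{(i ℕ.∸ j) !* (n ℕ.∸ i) !≢0}}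
    lhs : (n C i) ℕ.* (i C j) ℕ.* M ≡ n !
    lhs = trans (solve 5 (λ A B F G H → A :* B :* (F :* (G :* H)) := A :* (B :* (F :* G) :* H))
                  refl (n C i) (i C j) (j !) ((i ℕ.∸ j) !) ((n ℕ.∸ i) !))
          (trans (cong (λ z → (n C i) ℕ.* (z ℕ.* (n ℕ.∸ i) !)) (C*factorials j≤i)) (C*factorials i≤n))
    rhs : (n C j) ℕ.* ((n ℕ.∸ j) C (i ℕ.∸ j)) ℕ.* M ≡ n !
    rhs = trans (solve 5 (λ A B F G H → A :* B :* (F :* (G :* H)) := A :* (F :* (B :* (G :* H))))
                  refl (n C j) ((n ℕ.∸ j) C (i ℕ.∸ j)) (j !) ((i ℕ.∸ j) !) ((n ℕ.∸ i) !))
          (trans (cong (λ z → (n C j) ℕ.* (j ! ℕ.* (((n ℕ.∸ j) C (i ℕ.∸ j)) ℕ.* ((i ℕ.∸ j) ! ℕ.* z !))))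
                       (sym (∸-∸-cancel n j≤i)))
          (trans (cong (λ z → (n C j) ℕ.* (j ! ℕ.* z)) (C*factorials (∸-monoˡ-≤ j i≤n)))
                 (C*factorials (≤-trans j≤i i≤n))))

  C-disjoint-sym : ∀ m a b → (m C a) ℕ.* ((m ℕ.∸ a) C b) ≡ (m C b) ℕ.* ((m ℕ.∸ b) C a)
  C-disjoint-sym m a b =
    trans (sym (via-union a b))
          (trans (cong₂ (λ t z → (m C t) ℕ.* z) (+-comm a b) union-sym) (via-union b a))
    where
    via-union : ∀ a b → (m C (a ℕ.+ b)) ℕ.* ((a ℕ.+ b) C a) ≡ (m C a) ℕ.* ((m ℕ.∸ a) C b)
    via-union a b = trans (C-subset m (a ℕ.+ b) a (m≤m+n a b))
                          (cong (λ z → (m C a) ℕ.* ((m ℕ.∸ a) C z)) (m+n∸m≡n a b))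
    union-sym : ((a ℕ.+ b) C a) ≡ ((b ℕ.+ a) C b)
    union-sym = trans (nCk≡nC[n∸k] (m≤m+n a b)) (cong₂ _C_ (+-comm a b) (m+n∸m≡n a b))

  C-reciprocity : ∀ n i k j → j ℕ.≤ i → j ℕ.≤ k →
    (n C i) ℕ.* ((i C j) ℕ.* ((n ℕ.∸ i) C (k ℕ.∸ j))) ≡ (n C k) ℕ.* ((k C j) ℕ.* ((n ℕ.∸ k) C (i ℕ.∸ j)))
  C-reciprocity n i k j j≤i j≤k = begin
    (n C i) ℕ.* ((i C j) ℕ.* ((n ℕ.∸ i) C (k ℕ.∸ j)))
      ≡⟨ sym (*-assoc (n C i) (i C j) _) ⟩
    (n C i) ℕ.* (i C j) ℕ.* ((n ℕ.∸ i) C (k ℕ.∸ j))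
      ≡⟨ cong (ℕ._* ((n ℕ.∸ i) C (k ℕ.∸ j))) (C-subset n i j j≤i) ⟩
    (n C j) ℕ.* ((n ℕ.∸ j) C (i ℕ.∸ j)) ℕ.* ((n ℕ.∸ i) C (k ℕ.∸ j))
      ≡⟨ *-assoc (n C j) _ _ ⟩
    (n C j) ℕ.* (((n ℕ.∸ j) C (i ℕ.∸ j)) ℕ.* ((n ℕ.∸ i) C (k ℕ.∸ j)))
      ≡⟨ cong (λ z → (n C j) ℕ.* (((n ℕ.∸ j) C (i ℕ.∸ j)) ℕ.* (z C (k ℕ.∸ j)))) (sym (∸-∸-cancel n j≤i)) ⟩
    (n C j) ℕ.* (((n ℕ.∸ j) C (i ℕ.∸ j)) ℕ.* (((n ℕ.∸ j) ℕ.∸ (i ℕ.∸ j)) C (k ℕ.∸ j)))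
      ≡⟨ cong ((n C j) ℕ.*_) (C-disjoint-sym (n ℕ.∸ j) (i ℕ.∸ j) (k ℕ.∸ j)) ⟩
    (n C j) ℕ.* (((n ℕ.∸ j) C (k ℕ.∸ j)) ℕ.* (((n ℕ.∸ j) ℕ.∸ (k ℕ.∸ j)) C (i ℕ.∸ j)))
      ≡⟨ cong (λ z → (n C j) ℕ.* (((n ℕ.∸ j) C (k ℕ.∸ j)) ℕ.* (z C (i ℕ.∸ j)))) (∸-∸-cancel n j≤k) ⟩
    (n C j) ℕ.* (((n ℕ.∸ j) C (k ℕ.∸ j)) ℕ.* ((n ℕ.∸ k) C (i ℕ.∸ j)))
      ≡⟨ sym (*-assoc (n C j) _ _) ⟩
    (n C j) ℕ.* ((n ℕ.∸ j) C (k ℕ.∸ j)) ℕ.* ((n ℕ.∸ k) C (i ℕ.∸ j))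
      ≡⟨ cong (ℕ._* ((n ℕ.∸ k) C (i ℕ.∸ j))) (sym (C-subset n k j j≤k)) ⟩
    (n C k) ℕ.* (k C j) ℕ.* ((n ℕ.∸ k) C (i ℕ.∸ j))
      ≡⟨ *-assoc (n C k) (k C j) _ ⟩
    (n C k) ℕ.* ((k C j) ℕ.* ((n ℕ.∸ k) C (i ℕ.∸ j))) ∎
    where open P.≡-Reasoning

  pow-reciprocity : ∀ u i k j → j ℕ.≤ i → j ℕ.≤ k →
    u ℕ.^ i ℕ.* u ℕ.^ (k ℕ.∸ j) ≡ u ℕ.^ k ℕ.* u ℕ.^ (i ℕ.∸ j)
  pow-reciprocity u i k j j≤i j≤k =
    trans (sym (^-distribˡ-+-* u i (k ℕ.∸ j)))
          (trans (cong (u ℕ.^_) exponents) (^-distribˡ-+-* u k (i ℕ.∸ j)))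
    where
    exponents : i ℕ.+ (k ℕ.∸ j) ≡ k ℕ.+ (i ℕ.∸ j)
    exponents = trans (sym (+-∸-assoc i j≤k)) (trans (cong (ℕ._∸ j) (+-comm i k)) (+-∸-assoc k j≤i))

open Binomial

module OverOrderedField {c ℓ₁ ℓ₂} (F : OrderedField c ℓ₁ ℓ₂) where
  open OrderedField F renaming (_≤_ to infix 4 _≤F_; +-monoˡ-≤ to ≤F-monoˡ)
  open OverField F
  open IsTotalOrder isTotalOrder using (total; antisym)
    renaming (refl to ≤F-refl; trans to ≤F-trans; reflexive to ≤F-reflexive)
  open import Algebra.Properties.Ring ring
  open import Relation.Binary.Reasoning.Setoid setoid
  open +-*-Solver using ()
    renaming (solve to solveℕ; _:=_ to _:=ℕ_; _:+_ to _:+ℕ_; _:*_ to _:*ℕ_; con to conℕ)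

  ≤F-respʳ : ∀ {x y z} → y ≈ z → x ≤F y → x ≤F z
  ≤F-respʳ e p = ≤F-trans p (≤F-reflexive e)

  ≤F-respˡ : ∀ {x y z} → x ≈ y → x ≤F z → y ≤F z
  ≤F-respˡ e p = ≤F-trans (≤F-reflexive (sym e)) p

  fromℕ-+ : ∀ m n → fromℕ (m ℕ.+ n) ≈ fromℕ m + fromℕ n
  fromℕ-+ zero n = sym (+-identityˡ _)
  fromℕ-+ (suc m) n = trans (+-congˡ (fromℕ-+ m n)) (sym (+-assoc _ _ _))

  fromℕ-* : ∀ m n → fromℕ (m ℕ.* n) ≈ fromℕ m * fromℕ n
  fromℕ-* zero n = sym (zeroˡ _)
  fromℕ-* (suc m) n = begin
    fromℕ (n ℕ.+ m ℕ.* n) ≈⟨ fromℕ-+ n (m ℕ.* n) ⟩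
    fromℕ n + fromℕ (m ℕ.* n) ≈⟨ +-congˡ (fromℕ-* m n) ⟩
    fromℕ n + fromℕ m * fromℕ n ≈⟨ +-congʳ (sym (*-identityˡ _)) ⟩
    1# * fromℕ n + fromℕ m * fromℕ n ≈⟨ sym (distribʳ _ _ _) ⟩
    (1# + fromℕ m) * fromℕ n ∎

  fromℕ-∸ : ∀ m n → n ℕ.≤ m → fromℕ (m ℕ.∸ n) ≈ fromℕ m - fromℕ n
  fromℕ-∸ m n n≤m = begin
    fromℕ (m ℕ.∸ n) ≈⟨ sym (+-identityʳ _) ⟩
    fromℕ (m ℕ.∸ n) + 0# ≈⟨ +-congˡ (sym (-‿inverseʳ _)) ⟩
    fromℕ (m ℕ.∸ n) + (fromℕ n - fromℕ n) ≈⟨ sym (+-assoc _ _ _) ⟩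
    (fromℕ (m ℕ.∸ n) + fromℕ n) - fromℕ n ≈⟨ +-congʳ (sym (fromℕ-+ (m ℕ.∸ n) n)) ⟩
    fromℕ (m ℕ.∸ n ℕ.+ n) - fromℕ n ≈⟨ +-congʳ (reflexive (P.cong fromℕ (ℕP.m∸n+n≡m n≤m))) ⟩
    fromℕ m - fromℕ n ∎

  fromℕ-1 : fromℕ 1 ≈ 1#
  fromℕ-1 = +-identityʳ 1#

  fromℕ-cong : ∀ {m n} → m ≡ n → fromℕ m ≈ fromℕ n
  fromℕ-cong P.refl = refl

  fromℤ-⊖ : ∀ m n → fromℤ (m ℤ.⊖ n) ≈ fromℕ m - fromℕ n
  fromℤ-⊖ m n with ℕP.≤-<-connex n m
  ... | inj₁ n≤m = trans (reflexive (P.cong fromℤ (ℤP.⊖-≥ n≤m))) (fromℕ-∸ m n n≤m)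
  ... | inj₂ m<n = trans (reflexive (P.cong fromℤ (ℤP.⊖-< m<n))) (negative-case (n ℕ.∸ m) P.refl)
    where
    negative-case : ∀ k → k ≡ n ℕ.∸ m → fromℤ (ℤ.- (+ k)) ≈ fromℕ m - fromℕ n
    negative-case zero e = ⊥-elim (ℕP.<⇒≢ (ℕP.m<n⇒0<n∸m m<n) e)
    negative-case (suc k) e = begin
      - (1# + fromℕ k) ≈⟨ -‿cong (fromℕ-cong e) ⟩
      - fromℕ (n ℕ.∸ m) ≈⟨ -‿cong (fromℕ-∸ n m (ℕP.<⇒≤ m<n)) ⟩
      - (fromℕ n - fromℕ m) ≈⟨ -‿anti-homo-+ _ _ ⟩
      - (- fromℕ m) - fromℕ n ≈⟨ +-congʳ (-‿involutive _) ⟩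
      fromℕ m - fromℕ n ∎

  fromℤ-neg : ∀ x → fromℤ (ℤ.- x) ≈ - fromℤ x
  fromℤ-neg (+ zero) = sym -0#≈0#
  fromℤ-neg (+ suc n) = refl
  fromℤ-neg -[1+ n ] = sym (-‿involutive _)

  fromℤ-+ : ∀ x y → fromℤ (x ℤ.+ y) ≈ fromℤ x + fromℤ y
  fromℤ-+ -[1+ m ] -[1+ n ] = begin
    - fromℕ (suc (suc (m ℕ.+ n))) ≈⟨ -‿cong (fromℕ-cong (P.cong suc (P.sym (ℕP.+-suc m n)))) ⟩
    - fromℕ (suc m ℕ.+ suc n) ≈⟨ -‿cong (fromℕ-+ (suc m) (suc n)) ⟩
    - (fromℕ (suc m) + fromℕ (suc n)) ≈⟨ -‿anti-homo-+ _ _ ⟩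
    - fromℕ (suc n) - fromℕ (suc m) ≈⟨ +-comm _ _ ⟩
    - (1# + fromℕ m) + - (1# + fromℕ n) ∎
  fromℤ-+ -[1+ m ] (+ n) = trans (fromℤ-⊖ n (suc m)) (+-comm _ _)
  fromℤ-+ (+ m) -[1+ n ] = fromℤ-⊖ m (suc n)
  fromℤ-+ (+ m) (+ n) = fromℕ-+ m n

  σ : Sg.Sign → Carrier
  σ Sg.+ = 1#
  σ Sg.- = - 1#

  σ-* : ∀ s t → σ (s Sg.* t) ≈ σ s * σ t
  σ-* Sg.- Sg.- = sym (trans (sym (-‿distribˡ-* 1# (- 1#))) (trans (-‿cong (*-identityˡ _)) (-‿involutive _))) 
  σ-* Sg.- Sg.+ = sym (*-identityʳ _)
  σ-* Sg.+ Sg.- = sym (*-identityˡ _)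
  σ-* Sg.+ Sg.+ = sym (*-identityˡ _)

  fromℤ-◃ : ∀ s k → fromℤ (s ℤ.◃ k) ≈ σ s * fromℕ k
  fromℤ-◃ s zero = sym (zeroʳ _)
  fromℤ-◃ Sg.- (suc k) = sym (-1*x≈-x _)
  fromℤ-◃ Sg.+ (suc k) = sym (*-identityˡ _)

  fromℤ-sign-abs : ∀ x → fromℤ x ≈ σ (ℤ.sign x) * fromℕ ℤ.∣ x ∣
  fromℤ-sign-abs (+ n) = sym (*-identityˡ _)
  fromℤ-sign-abs -[1+ n ] = sym (-1*x≈-x _)

  fromℤ-* : ∀ x y → fromℤ (x ℤ.* y) ≈ fromℤ x * fromℤ y
  fromℤ-* x y = begin
    fromℤ (x ℤ.* y) ≈⟨ fromℤ-◃ (ℤ.sign x Sg.* ℤ.sign y) (ℤ.∣ x ∣ ℕ.* ℤ.∣ y ∣) ⟩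
    σ (ℤ.sign x Sg.* ℤ.sign y) * fromℕ (ℤ.∣ x ∣ ℕ.* ℤ.∣ y ∣) ≈⟨ *-cong (σ-* sx sy) (fromℕ-* ax ay) ⟩
    (σ sx * σ sy) * (fromℕ ax * fromℕ ay) ≈⟨ *-assoc _ _ _ ⟩
    σ sx * (σ sy * (fromℕ ax * fromℕ ay)) ≈⟨ *-congˡ (sym (*-assoc _ _ _)) ⟩
    σ sx * ((σ sy * fromℕ ax) * fromℕ ay) ≈⟨ *-congˡ (*-congʳ (*-comm _ _)) ⟩
    σ sx * ((fromℕ ax * σ sy) * fromℕ ay) ≈⟨ *-congˡ (*-assoc _ _ _) ⟩
    σ sx * (fromℕ ax * (σ sy * fromℕ ay)) ≈⟨ sym (*-assoc _ _ _) ⟩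
    (σ sx * fromℕ ax) * (σ sy * fromℕ ay) ≈⟨ *-cong (sym (fromℤ-sign-abs x)) (sym (fromℤ-sign-abs y)) ⟩
    fromℤ x * fromℤ y ∎
    where
    sx sy : Sg.Sign
    sx = ℤ.sign x
    sy = ℤ.sign y
    ax ay : ℕ
    ax = ℤ.∣ x ∣
    ay = ℤ.∣ y ∣

  module SolverSetup where
    open import Algebra.Solver.Ring.AlmostCommutativeRing
    open import Data.Maybe using (Maybe; just; nothing)

    almostCommutativeRing : AlmostCommutativeRing c ℓ₁
    almostCommutativeRing = fromCommutativeRing commutativeRing

    -- Integer coefficients are interpreted by ι, which agrees with fromℤ but
    -- sends 1 to 1# itself, so that the solver's constants are the goal's.
    ιℕ : ℕ → Carrier
    ιℕ zero = 0#
    ιℕ (suc zero) = 1#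
    ιℕ (suc (suc n)) = 1# + ιℕ (suc n)

    ιℕ≈fromℕ : ∀ n → ιℕ n ≈ fromℕ n
    ιℕ≈fromℕ zero = refl
    ιℕ≈fromℕ (suc zero) = sym (+-identityʳ 1#)
    ιℕ≈fromℕ (suc (suc n)) = +-congˡ (ιℕ≈fromℕ (suc n))

    ι : ℤ → Carrier
    ι (+ n) = ιℕ n
    ι -[1+ n ] = - ιℕ (suc n)

    ι≈fromℤ : ∀ x → ι x ≈ fromℤ x
    ι≈fromℤ (+ n) = ιℕ≈fromℕ n
    ι≈fromℤ -[1+ n ] = -‿cong (ιℕ≈fromℕ (suc n))

    ι-morphism : ℤ.+-*-rawRing -Raw-AlmostCommutative⟶ almostCommutativeRing
    ι-morphism = record
      { ⟦_⟧ = ι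
      ; +-homo = λ x y → trans (ι≈fromℤ (x ℤ.+ y)) (trans (fromℤ-+ x y) (sym (+-cong (ι≈fromℤ x) (ι≈fromℤ y))))
      ; *-homo = λ x y → trans (ι≈fromℤ (x ℤ.* y)) (trans (fromℤ-* x y) (sym (*-cong (ι≈fromℤ x) (ι≈fromℤ y))))
      ; -‿homo = λ x → trans (ι≈fromℤ (ℤ.- x)) (trans (fromℤ-neg x) (sym (-‿cong (ι≈fromℤ x))))
      ; 0-homo = refl ; 1-homo = refl }

    coefficient-equal? : ∀ x y → Maybe (ι x ≈ ι y)
    coefficient-equal? x y with x ℤ.≟ y
    ... | yes P.refl = just refl
    ... | no _ = nothing
  open import Algebra.Solver.Ring ℤ.+-*-rawRing SolverSetup.almostCommutativeRing
                                  SolverSetup.ι-morphism SolverSetup.coefficient-equal?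
    using (solve; _:=_; _:+_; _:*_; :-_; _:-_; con)

  ≤F-monoʳ : ∀ {x y} z → x ≤F y → z + x ≤F z + y
  ≤F-monoʳ z p = ≤F-respˡ (+-comm _ _) (≤F-respʳ (+-comm _ _) (≤F-monoˡ z p))

  ≤F-+ : ∀ {x y z w} → x ≤F y → z ≤F w → x + z ≤F y + w
  ≤F-+ {x} {y} {z} {w} p q = ≤F-trans (≤F-monoˡ z p) (≤F-monoʳ y q)

  nonneg-+ : ∀ {x y} → 0# ≤F x → 0# ≤F y → 0# ≤F x + y
  nonneg-+ p q = ≤F-respˡ (+-identityʳ 0#) (≤F-+ p q)

  ≤0⇒0≤- : ∀ {x} → x ≤F 0# → 0# ≤F - x
  ≤0⇒0≤- {x} p = ≤F-respˡ (-‿inverseʳ x) (≤F-respʳ (+-identityˡ (- x)) (≤F-monoˡ (- x) p))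

  0≤-⇒≤0 : ∀ {x} → 0# ≤F - x → x ≤F 0#
  0≤-⇒≤0 {x} p = ≤F-respˡ (+-identityˡ x) (≤F-respʳ (-‿inverseˡ x) (≤F-monoˡ x p))

  -- 0 ≤ 1, since otherwise 1 = (-1)(-1) ≥ 0 anyway.
  0≤1 : 0# ≤F 1#
  0≤1 with total 0# 1#
  ... | inj₁ p = p
  ... | inj₂ p = ≤F-respʳ e (*-nonneg (≤0⇒0≤- p) (≤0⇒0≤- p))
    where
    e : - 1# * - 1# ≈ 1#
    e = trans (sym (-‿distribˡ-* 1# (- 1#))) (trans (-‿cong (*-identityˡ _)) (-‿involutive _))

  fromℕ≥0 : ∀ m → 0# ≤F fromℕ m
  fromℕ≥0 zero = ≤F-refl
  fromℕ≥0 (suc m) = nonneg-+ 0≤1 (fromℕ≥0 m)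

  1≤1+ : ∀ m → 1# ≤F fromℕ (suc m)
  1≤1+ m = ≤F-respˡ (+-identityʳ 1#) (≤F-monoʳ 1# (fromℕ≥0 m))

  fromℕ-suc≉0 : ∀ m → ¬ (fromℕ (suc m) ≈ 0#)
  fromℕ-suc≉0 m e = 0≉1 (sym (antisym (≤F-respʳ e (1≤1+ m)) 0≤1))

  fromℕ≉0 : ∀ m → ¬ (m ≡ 0) → ¬ (fromℕ m ≈ 0#)
  fromℕ≉0 zero ne = ⊥-elim (ne P.refl)
  fromℕ≉0 (suc m) ne = fromℕ-suc≉0 m

  inv-r : ∀ {x} → ¬ (x ≈ 0#) → x * x ⁻¹ ≈ 1#
  inv-r {x} ne = ⁻¹-inverse x ne

  inv-l : ∀ {x} → ¬ (x ≈ 0#) → x ⁻¹ * x ≈ 1#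
  inv-l {x} ne = trans (*-comm _ _) (inv-r ne)

  mul-cancelˡ : ∀ {x a b} → ¬ (x ≈ 0#) → x * a ≈ x * b → a ≈ b
  mul-cancelˡ {x} {a} {b} ne e = begin
    a ≈⟨ sym (*-identityˡ a) ⟩
    1# * a ≈⟨ *-congʳ (sym (inv-l ne)) ⟩
    (x ⁻¹ * x) * a ≈⟨ *-assoc _ _ _ ⟩
    x ⁻¹ * (x * a) ≈⟨ *-congˡ e ⟩
    x ⁻¹ * (x * b) ≈⟨ sym (*-assoc _ _ _) ⟩
    (x ⁻¹ * x) * b ≈⟨ *-congʳ (inv-l ne) ⟩
    1# * b ≈⟨ *-identityˡ b ⟩
    b ∎

  zero-prod : ∀ {x y} → ¬ (x ≈ 0#) → x * y ≈ 0# → y ≈ 0#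
  zero-prod {x} {y} ne e = mul-cancelˡ ne (trans e (sym (zeroʳ x)))

  prod≉0 : ∀ {x y} → ¬ (x ≈ 0#) → ¬ (y ≈ 0#) → ¬ (x * y ≈ 0#)
  prod≉0 nx ny e = ny (zero-prod nx e)

  inv≥0 : ∀ {x} → 0# ≤F x → ¬ (x ≈ 0#) → 0# ≤F x ⁻¹
  inv≥0 {x} p ne with total 0# (x ⁻¹)
  ... | inj₁ q = q
  ... | inj₂ q = ⊥-elim (0≉1 (sym (antisym 1≤0 0≤1)))
    where
    x·-x⁻¹≥0 : 0# ≤F x * - (x ⁻¹)
    x·-x⁻¹≥0 = *-nonneg p (≤0⇒0≤- q)
    -1≥0 : 0# ≤F - 1#
    -1≥0 = ≤F-respʳ (trans (sym (-‿distribʳ-* x (x ⁻¹))) (-‿cong (inv-r ne))) x·-x⁻¹≥0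
    1≤0 : 1# ≤F 0#
    1≤0 = 0≤-⇒≤0 -1≥0

  nonneg-cancel : ∀ {x y} → 0# ≤F x → ¬ (x ≈ 0#) → 0# ≤F x * y → 0# ≤F y
  nonneg-cancel {x} {y} p ne q = ≤F-respʳ e (*-nonneg (inv≥0 p ne) q)
    where
    e : x ⁻¹ * (x * y) ≈ y
    e = trans (sym (*-assoc _ _ _)) (trans (*-congʳ (inv-l ne)) (*-identityˡ y))

  ≈0⇒≥0 : ∀ {x} → x ≈ 0# → 0# ≤F x
  ≈0⇒≥0 e = ≤F-respʳ (sym e) ≤F-refl

  sq≥0 : ∀ x → 0# ≤F x * x
  sq≥0 x with total 0# x
  ... | inj₁ p = *-nonneg p p
  ... | inj₂ p = ≤F-respʳ e (*-nonneg (≤0⇒0≤- p) (≤0⇒0≤- p))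
    where
    e : - x * - x ≈ x * x
    e = solve 1 (λ X' → (:- X') :* (:- X') := X' :* X') refl x

  neg≉0 : ∀ {x} → ¬ (x ≈ 0#) → ¬ (- x ≈ 0#)
  neg≉0 {x} ne e = ne (trans (sym (-‿involutive x)) (trans (-‿cong e) -0#≈0#))

  -- The order of F is not decidable, but on integer values it is: the sign
  -- of the integer decides the case, so ¬¬-nonnegativity suffices.
  integral-nonneg : ∀ z {x} → fromℤ z ≈ x → ¬ ¬ (0# ≤F x) → 0# ≤F x
  integral-nonneg (+ m) e _ = ≤F-respʳ e (fromℕ≥0 m)
  integral-nonneg -[1+ m ] e nn = ⊥-elim (nn (λ p →
    fromℕ-suc≉0 m (antisym (0≤-⇒≤0 (≤F-respʳ (sym e) p)) (fromℕ≥0 (suc m)))))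

  Σ-cong : ∀ {f g : ℕ → Carrier} m → (∀ i → i ℕ.< m → f i ≈ g i) → Σ< f m ≈ Σ< g m
  Σ-cong zero h = refl
  Σ-cong (suc m) h = +-cong (Σ-cong m (λ i i<m → h i (ℕP.m<n⇒m<1+n i<m))) (h m (ℕP.n<1+n m))

  Σ-cong′ : ∀ {f g : ℕ → Carrier} m → (∀ i → f i ≈ g i) → Σ< f m ≈ Σ< g m
  Σ-cong′ m h = Σ-cong m (λ i _ → h i)

  Σ-+ : ∀ (f g : ℕ → Carrier) m → Σ< (λ i → f i + g i) m ≈ Σ< f m + Σ< g m
  Σ-+ f g zero = sym (+-identityˡ 0#)
  Σ-+ f g (suc m) = begin
    Σ< (λ i → f i + g i) m + (f m + g m) ≈⟨ +-congʳ (Σ-+ f g m) ⟩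
    (Σ< f m + Σ< g m) + (f m + g m)
      ≈⟨ solve 4 (λ a b x y → (a :+ b) :+ (x :+ y) := (a :+ x) :+ (b :+ y)) refl (Σ< f m) (Σ< g m) (f m) (g m) ⟩
    (Σ< f m + f m) + (Σ< g m + g m) ∎

  Σ-*ˡ : ∀ c (f : ℕ → Carrier) m → Σ< (λ i → c * f i) m ≈ c * Σ< f m
  Σ-*ˡ c f zero = sym (zeroʳ c)
  Σ-*ˡ c f (suc m) = trans (+-congʳ (Σ-*ˡ c f m)) (sym (distribˡ c _ _))

  Σ-*ʳ : ∀ c (f : ℕ → Carrier) m → Σ< (λ i → f i * c) m ≈ Σ< f m * c
  Σ-*ʳ c f m = trans (Σ-cong′ m (λ i → *-comm (f i) c)) (trans (Σ-*ˡ c f m) (*-comm c _))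

  Σ-neg : ∀ (f : ℕ → Carrier) m → Σ< (λ i → - f i) m ≈ - Σ< f m
  Σ-neg f zero = sym -0#≈0#
  Σ-neg f (suc m) = trans (+-congʳ (Σ-neg f m)) (trans (+-comm _ _) (sym (-‿anti-homo-+ _ _)))

  Σ-0 : ∀ {f : ℕ → Carrier} m → (∀ i → i ℕ.< m → f i ≈ 0#) → Σ< f m ≈ 0#
  Σ-0 {f} m h = trans (Σ-cong m h) (z m)
    where
    z : ∀ m → Σ< (λ _ → 0#) m ≈ 0#
    z zero = refl
    z (suc m) = trans (+-identityʳ _) (z m)

  Σ-swap : ∀ (f : ℕ → ℕ → Carrier) m k →
    Σ< (λ i → Σ< (λ j → f i j) k) m ≈ Σ< (λ j → Σ< (λ i → f i j) m) k
  Σ-swap f zero k = sym (Σ-0 k (λ _ _ → refl))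
  Σ-swap f (suc m) k = begin
    Σ< (λ i → Σ< (λ j → f i j) k) m + Σ< (λ j → f m j) k ≈⟨ +-congʳ (Σ-swap f m k) ⟩
    Σ< (λ j → Σ< (λ i → f i j) m) k + Σ< (λ j → f m j) k ≈⟨ sym (Σ-+ _ _ k) ⟩
    Σ< (λ j → Σ< (λ i → f i j) m + f m j) k ∎

  Σ-shift : ∀ (f : ℕ → Carrier) m → Σ< f (suc m) ≈ f 0 + Σ< (λ i → f (suc i)) m
  Σ-shift f zero = trans (+-identityˡ _) (sym (+-identityʳ _))
  Σ-shift f (suc m) = trans (+-congʳ (Σ-shift f m)) (+-assoc _ _ _)

  Σ-trunc : ∀ {f : ℕ → Carrier} m M → m ℕ.≤ M → (∀ i → m ℕ.≤ i → i ℕ.< M → f i ≈ 0#) → Σ< f M ≈ Σ< f m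
  Σ-trunc {f} m zero m≤M h with ℕP.n≤0⇒n≡0 m≤M
  ... | P.refl = refl
  Σ-trunc {f} m (suc M) m≤M h with ℕP.m≤n⇒m<n∨m≡n m≤M
  ... | inj₂ P.refl = refl
  ... | inj₁ m<M = trans (+-congˡ (h M (ℕP.<⇒≤pred m<M) (ℕP.n<1+n M)))
          (trans (+-identityʳ _) (Σ-trunc m M (ℕP.<⇒≤pred m<M) (λ i p q → h i p (ℕP.m<n⇒m<1+n q))))

  Σ-delta : ∀ {f : ℕ → Carrier} m k → k ℕ.< m → (∀ i → i ℕ.< m → ¬ (i ≡ k) → f i ≈ 0#) → Σ< f m ≈ f k
  Σ-delta {f} (suc m) k k<m h with k ℕ.≟ m
  ... | yes P.refl = trans (+-congʳ (Σ-0 m (λ i i<m → h i (ℕP.m<n⇒m<1+n i<m) (λ e → ℕP.<⇒≢ i<m e)))) (+-identityˡ _)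
  ... | no k≢m = trans (+-congˡ (h m (ℕP.n<1+n m) (λ e → k≢m (P.sym e))))
      (trans (+-identityʳ _) (Σ-delta m k (ℕP.≤∧≢⇒< (ℕP.≤-pred k<m) k≢m) (λ i i<m → h i (ℕP.m<n⇒m<1+n i<m))))

  Σ-nonneg : ∀ {f : ℕ → Carrier} m → (∀ i → i ℕ.< m → 0# ≤F f i) → 0# ≤F Σ< f m
  Σ-nonneg zero h = ≤F-refl
  Σ-nonneg (suc m) h = nonneg-+ (Σ-nonneg m (λ i i<m → h i (ℕP.m<n⇒m<1+n i<m))) (h m (ℕP.n<1+n m))

  Σ-≥term : ∀ {f : ℕ → Carrier} m k → k ℕ.< m → (∀ i → i ℕ.< m → 0# ≤F f i) → f k ≤F Σ< f m
  Σ-≥term {f} (suc m) k k<m h with k ℕ.≟ m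
  ... | yes P.refl = ≤F-respˡ (+-identityˡ _) (≤F-monoˡ (f k) (Σ-nonneg m (λ i i<m → h i (ℕP.m<n⇒m<1+n i<m))))
  ... | no k≢m = ≤F-respˡ (+-identityʳ _)
    (≤F-+ (Σ-≥term m k (ℕP.≤∧≢⇒< (ℕP.≤-pred k<m) k≢m) (λ i i<m → h i (ℕP.m<n⇒m<1+n i<m))) (h m (ℕP.n<1+n m)))

  Σ-triangle : ∀ (f : ℕ → ℕ → Carrier) N →
    Σ< (λ i → Σ< (λ j → f j (i ℕ.∸ j)) (suc i)) N ≈ Σ< (λ j → Σ< (λ m → f j m) (N ℕ.∸ j)) N
  Σ-triangle f zero = refl
  Σ-triangle f (suc N) = begin
    Σ< (λ i → Σ< (λ j → f j (i ℕ.∸ j)) (suc i)) N + Σ< (λ j → f j (N ℕ.∸ j)) (suc N) ≈⟨ +-congʳ (Σ-triangle f N) ⟩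
    Σ< (λ j → Σ< (λ m → f j m) (N ℕ.∸ j)) N + Σ< (λ j → f j (N ℕ.∸ j)) (suc N) ≈⟨ +-congʳ (sym drop-empty-row) ⟩
    Σ< (λ j → Σ< (λ m → f j m) (N ℕ.∸ j)) (suc N) + Σ< (λ j → f j (N ℕ.∸ j)) (suc N) ≈⟨ sym (Σ-+ _ _ (suc N)) ⟩
    Σ< (λ j → Σ< (λ m → f j m) (N ℕ.∸ j) + f j (N ℕ.∸ j)) (suc N) ≈⟨ Σ-cong (suc N) extend-row ⟩
    Σ< (λ j → Σ< (λ m → f j m) (suc N ℕ.∸ j)) (suc N) ∎
    where
    drop-empty-row : Σ< (λ j → Σ< (λ m → f j m) (N ℕ.∸ j)) (suc N) ≈ Σ< (λ j → Σ< (λ m → f j m) (N ℕ.∸ j)) N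
    drop-empty-row = trans (+-congˡ (reflexive (P.cong (Σ< (f N)) (ℕP.n∸n≡0 N)))) (+-identityʳ _)
    extend-row : ∀ j → j ℕ.< suc N → Σ< (λ m → f j m) (N ℕ.∸ j) + f j (N ℕ.∸ j) ≈ Σ< (λ m → f j m) (suc N ℕ.∸ j)
    extend-row j j<N = reflexive (P.cong (Σ< (f j)) (P.sym (ℕP.+-∸-assoc 1 (ℕP.≤-pred j<N))))


  Σ-¬¬-single : ∀ (t : ℕ → Carrier) m →
    (∀ i → 1 ℕ.≤ i → i ℕ.≤ m → ¬ ¬ (t i ≈ 0#)) → ¬ ¬ (Σ< t (suc m) ≈ t 0)
  Σ-¬¬-single t zero hyp k = k (+-identityˡ _)
  Σ-¬¬-single t (suc m) hyp k = Σ-¬¬-single t m (λ i p q → hyp i p (ℕP.m≤n⇒m≤1+n q))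
    (λ e₁ → hyp (suc m) (s≤s z≤n) ℕP.≤-refl (λ e₂ → k (trans (+-cong e₁ e₂) (+-identityʳ _))))

  Σ-sub₂ : ∀ (f g h : ℕ → Carrier) m → Σ< (λ i → f i - g i - h i) m ≈ Σ< f m - Σ< g m - Σ< h m
  Σ-sub₂ f g h m = trans (Σ-+ _ _ m) (+-cong (trans (Σ-+ _ _ m) (+-congˡ (Σ-neg g m))) (Σ-neg h m))

  fromℤ-Σ : ∀ (f : ℕ → ℤ) m → fromℤ (sumℤ f m) ≈ Σ< (λ i → fromℤ (f i)) m
  fromℤ-Σ f zero = refl
  fromℤ-Σ f (suc m) = trans (fromℤ-+ (sumℤ f m) (f m)) (+-congʳ (fromℤ-Σ f m))

  sg : ℕ → Carrier
  sg j = fromℤ (signℤ j)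

  sg-suc : ∀ j → sg (suc j) ≈ - sg j
  sg-suc zero = refl
  sg-suc (suc j) = sym (trans (-‿cong (sg-suc j)) (-‿involutive _))


  -- A convolution c_k = Σ_j a_j b_{k-j} of a sequence with
  -- (j+1) a_{j+1} = -(X - j) a_j (an alternating binomial row) and one with
  -- (m+1) b_{m+1} = U (Y - m) b_m (a weighted binomial row) satisfies
  --   (k+2) c_{k+2} = (UY - X + (k+1)(1-U)) c_{k+1} - U (X + Y - k) c_k.
  -- The Krawtchouk polynomial K_k(x) is such a convolution (X = x, Y = n - x).
  module ConvolutionRecurrence (a b : ℕ → Carrier) (X Y U : Carrier)
    (a-step : ∀ j → fromℕ (suc j) * a (suc j) ≈ - ((X - fromℕ j) * a j))
    (b-step : ∀ m → fromℕ (suc m) * b (suc m) ≈ U * ((Y - fromℕ m) * b m)) where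

    term : ℕ → ℕ → Carrier
    term k j = a j * b (k ℕ.∸ j)

    conv : ℕ → Carrier
    conv k = Σ< (term k) (suc k)

    moment₁ moment₂ : ℕ → Carrier
    moment₁ k = Σ< (λ j → fromℕ j * term k j) (suc k)
    moment₂ k = Σ< (λ j → fromℕ (k ℕ.∸ j) * term k j) (suc k)

    moment-split : ∀ k → fromℕ k * conv k ≈ moment₁ k + moment₂ k
    moment-split k = begin
      fromℕ k * conv k ≈⟨ sym (Σ-*ˡ (fromℕ k) (term k) (suc k)) ⟩
      Σ< (λ j → fromℕ k * term k j) (suc k) ≈⟨ Σ-cong (suc k) summand ⟩
      Σ< (λ j → fromℕ j * term k j + fromℕ (k ℕ.∸ j) * term k j) (suc k) ≈⟨ Σ-+ _ _ (suc k) ⟩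
      moment₁ k + moment₂ k ∎
      where
      summand : ∀ j → j ℕ.< suc k → fromℕ k * term k j ≈ fromℕ j * term k j + fromℕ (k ℕ.∸ j) * term k j
      summand j j<k = trans (*-congʳ (trans (fromℕ-cong (P.sym (ℕP.m+[n∸m]≡n (ℕP.≤-pred j<k)))) (fromℕ-+ j (k ℕ.∸ j))))
                            (distribʳ _ _ _)

    moment₁-step : ∀ k → moment₁ (suc k) ≈ - (X * conv k) + moment₁ k
    moment₁-step k = begin
      moment₁ (suc k) ≈⟨ Σ-shift _ (suc k) ⟩
      fromℕ 0 * term (suc k) 0 + Σ< (λ j → fromℕ (suc j) * term (suc k) (suc j)) (suc k)
        ≈⟨ trans (+-cong (zeroˡ _) (Σ-cong′ (suc k) summand)) (+-identityˡ _) ⟩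
      Σ< (λ j → - (X * term k j) + fromℕ j * term k j) (suc k) ≈⟨ Σ-+ _ _ (suc k) ⟩
      Σ< (λ j → - (X * term k j)) (suc k) + moment₁ k
        ≈⟨ +-congʳ (trans (Σ-neg _ (suc k)) (-‿cong (Σ-*ˡ X (term k) (suc k)))) ⟩
      - (X * conv k) + moment₁ k ∎
      where
      summand : ∀ j → fromℕ (suc j) * term (suc k) (suc j) ≈ - (X * term k j) + fromℕ j * term k j
      summand j = begin
        fromℕ (suc j) * (a (suc j) * b (k ℕ.∸ j)) ≈⟨ sym (*-assoc _ _ _) ⟩
        (fromℕ (suc j) * a (suc j)) * b (k ℕ.∸ j) ≈⟨ *-congʳ (a-step j) ⟩
        (- ((X - fromℕ j) * a j)) * b (k ℕ.∸ j)
          ≈⟨ solve 4 (λ X' J A B → (:- ((X' :- J) :* A)) :* B := (:- (X' :* (A :* B))) :+ (J :* (A :* B)))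
               refl X (fromℕ j) (a j) (b (k ℕ.∸ j)) ⟩
        - (X * term k j) + fromℕ j * term k j ∎

    moment₂-step : ∀ k → moment₂ (suc k) ≈ U * (Y * conv k) - U * moment₂ k
    moment₂-step k = begin
      moment₂ (suc k) ≈⟨ trans (+-congˡ last-zero) (+-identityʳ _) ⟩
      Σ< shifted (suc k) ≈⟨ Σ-cong (suc k) (λ j j<k → shifted-summand j (ℕP.≤-pred j<k)) ⟩
      Σ< (λ j → U * (Y * term k j) + - (U * (fromℕ (k ℕ.∸ j) * term k j))) (suc k) ≈⟨ Σ-+ _ _ (suc k) ⟩
      Σ< (λ j → U * (Y * term k j)) (suc k) + Σ< (λ j → - (U * (fromℕ (k ℕ.∸ j) * term k j))) (suc k)
        ≈⟨ +-cong (trans (Σ-*ˡ U _ (suc k)) (*-congˡ (Σ-*ˡ Y (term k) (suc k))))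
                  (trans (Σ-neg _ (suc k)) (-‿cong (Σ-*ˡ U _ (suc k)))) ⟩
      U * (Y * conv k) - U * moment₂ k ∎
      where
      shifted : ℕ → Carrier
      shifted j = fromℕ (suc k ℕ.∸ j) * term (suc k) j
      last-zero : shifted (suc k) ≈ 0#
      last-zero = trans (*-congʳ (fromℕ-cong (ℕP.n∸n≡0 k))) (zeroˡ _)
      shifted-summand : ∀ j → j ℕ.≤ k → shifted j ≈ U * (Y * term k j) + - (U * (fromℕ (k ℕ.∸ j) * term k j))
      shifted-summand j j≤k = via-pred (k ℕ.∸ j) (ℕP.+-∸-assoc 1 j≤k)
        where
        via-pred : ∀ m → suc k ℕ.∸ j ≡ suc m → shifted j ≈ U * (Y * (a j * b m)) + - (U * (fromℕ m * (a j * b m)))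
        via-pred m e = begin
          fromℕ (suc k ℕ.∸ j) * (a j * b (suc k ℕ.∸ j)) ≈⟨ *-cong (fromℕ-cong e) (*-congˡ (reflexive (P.cong b e))) ⟩
          fromℕ (suc m) * (a j * b (suc m))
            ≈⟨ solve 3 (λ M' A B → M' :* (A :* B) := A :* (M' :* B)) refl (fromℕ (suc m)) (a j) (b (suc m)) ⟩
          a j * (fromℕ (suc m) * b (suc m)) ≈⟨ *-congˡ (b-step m) ⟩
          a j * (U * ((Y - fromℕ m) * b m))
            ≈⟨ solve 5 (λ A U' Y' M' B → A :* (U' :* ((Y' :- M') :* B)) := (U' :* (Y' :* (A :* B))) :+ (:- (U' :* (M' :* (A :* B)))))
                 refl (a j) U Y (fromℕ m) (b m) ⟩
          U * (Y * (a j * b m)) + - (U * (fromℕ m * (a j * b m))) ∎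

    moment₂-zero : moment₂ 0 ≈ 0#
    moment₂-zero = trans (+-identityˡ _) (zeroˡ _)

    moment₁-eliminate : ∀ k → moment₁ k ≈ fromℕ k * conv k - moment₂ k
    moment₁-eliminate k = trans (solve 2 (λ S' M' → S' := (S' :+ M') :- M') refl (moment₁ k) (moment₂ k))
                                (+-congʳ (sym (moment-split k)))

    conv-step : ∀ k → fromℕ (suc k) * conv (suc k) ≈ (U * Y - X + fromℕ k) * conv k - (1# + U) * moment₂ k
    conv-step k = begin
      fromℕ (suc k) * conv (suc k) ≈⟨ moment-split (suc k) ⟩
      moment₁ (suc k) + moment₂ (suc k) ≈⟨ +-cong (trans (moment₁-step k) (+-congˡ (moment₁-eliminate k))) (moment₂-step k) ⟩
      (- (X * conv k) + (fromℕ k * conv k - moment₂ k)) + (U * (Y * conv k) - U * moment₂ k)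
        ≈⟨ solve 6 (λ X' Y' U' k' K' M' → ((:- (X' :* K')) :+ ((k' :* K') :- M')) :+ ((U' :* (Y' :* K')) :- (U' :* M'))
                     := (((U' :* Y') :- X') :+ k') :* K' :- ((con (+ 1) :+ U') :* M'))
             refl X Y U (fromℕ k) (conv k) (moment₂ k) ⟩
      (U * Y - X + fromℕ k) * conv k - (1# + U) * moment₂ k ∎

    recurrence-base : fromℕ 1 * conv 1 ≈ (U * Y - X) * conv 0
    recurrence-base = begin
      fromℕ 1 * conv 1 ≈⟨ conv-step 0 ⟩
      (U * Y - X + 0#) * conv 0 - (1# + U) * moment₂ 0 ≈⟨ +-congˡ (-‿cong (*-congˡ moment₂-zero)) ⟩
      (U * Y - X + 0#) * conv 0 - (1# + U) * 0#
        ≈⟨ solve 4 (λ X' Y' U' K' → (((U' :* Y') :- X') :+ con (+ 0)) :* K' :- ((con (+ 1) :+ U') :* con (+ 0))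
                     := ((U' :* Y') :- X') :* K') refl X Y U (conv 0) ⟩
      (U * Y - X) * conv 0 ∎

    moment₂-eliminate : ∀ k → (1# + U) * moment₂ k ≈ (U * Y - X + fromℕ k) * conv k - fromℕ (suc k) * conv (suc k)
    moment₂-eliminate k =
      trans (solve 2 (λ W Z → Z := W :- (W :- Z)) refl ((U * Y - X + fromℕ k) * conv k) ((1# + U) * moment₂ k))
            (+-congˡ (-‿cong (sym (conv-step k))))

    -- Eliminating moment₂ between two consecutive steps: the three-term recurrence.
    recurrence : ∀ k → fromℕ (suc (suc k)) * conv (suc (suc k)) ≈
           (U * Y - X + fromℕ (suc k) * (1# - U)) * conv (suc k) - U * (X + Y - fromℕ k) * conv k
    recurrence k = begin
      fromℕ (suc (suc k)) * conv (suc (suc k)) ≈⟨ conv-step (suc k) ⟩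
      c₁ - (1# + U) * moment₂ (suc k) ≈⟨ +-congˡ (-‿cong (*-congˡ (moment₂-step k))) ⟩
      c₁ - (1# + U) * (U * (Y * conv k) - U * moment₂ k)
        ≈⟨ solve 5 (λ U' Y' C₁ K0 Mk → C₁ :- ((con (+ 1) :+ U') :* ((U' :* (Y' :* K0)) :- (U' :* Mk)))
                     := (C₁ :- ((con (+ 1) :+ U') :* (U' :* (Y' :* K0)))) :+ (U' :* ((con (+ 1) :+ U') :* Mk)))
             refl U Y c₁ (conv k) (moment₂ k) ⟩
      (c₁ - (1# + U) * (U * (Y * conv k))) + U * ((1# + U) * moment₂ k) ≈⟨ +-congˡ (*-congˡ (moment₂-eliminate k)) ⟩
      (c₁ - (1# + U) * (U * (Y * conv k))) + U * ((U * Y - X + fromℕ k) * conv k - fromℕ (suc k) * conv (suc k))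
        ≈⟨ solve 7 (λ X' Y' U' k' K1 K0 Mk →
                     (((((U' :* Y') :- X') :+ (con (+ 1) :+ k')) :* K1) :- ((con (+ 1) :+ U') :* (U' :* (Y' :* K0))))
                       :+ (U' :* ((((U' :* Y') :- X') :+ k') :* K0 :- ((con (+ 1) :+ k') :* K1)))
                     := ((((U' :* Y') :- X') :+ ((con (+ 1) :+ k') :* (con (+ 1) :- U'))) :* K1) :- ((U' :* ((X' :+ Y') :- k')) :* K0))
             refl X Y U (fromℕ k) (conv (suc k)) (conv k) (moment₂ k) ⟩
      (U * Y - X + fromℕ (suc k) * (1# - U)) * conv (suc k) - U * (X + Y - fromℕ k) * conv k ∎
      where
      c₁ : Carrier
      c₁ = (U * Y - X + fromℕ (suc k)) * conv (suc k)

  ∸-beside : ∀ x j m → (x ℕ.< j → m ≡ 0) → fromℕ (x ℕ.∸ j) * fromℕ m ≈ (fromℕ x - fromℕ j) * fromℕ m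
  ∸-beside x j m m≡0 with ℕP.≤-<-connex j x
  ... | inj₁ j≤x = *-congʳ (fromℕ-∸ x j j≤x)
  ... | inj₂ x<j = trans (*-congˡ m≈0) (trans (zeroʳ _) (sym (trans (*-congˡ m≈0) (zeroʳ _))))
    where
    m≈0 : fromℕ m ≈ 0#
    m≈0 = fromℕ-cong (m≡0 x<j)

  alternating-partial-sum : ∀ x M → Σ< (λ j → sg j * fromℕ (suc x C j)) (suc M) ≈ sg M * fromℕ (x C M)
  alternating-partial-sum x zero = +-identityˡ _
  alternating-partial-sum x (suc M) = begin
    Σ< (λ j → sg j * fromℕ (suc x C j)) (suc M) + sg (suc M) * fromℕ (suc x C suc M)
      ≈⟨ +-cong (alternating-partial-sum x M) (*-cong (sg-suc M) pascal) ⟩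
    sg M * fromℕ (x C M) + (- sg M) * (fromℕ (x C M) + fromℕ (x C suc M))
      ≈⟨ solve 3 (λ S' A B → (S' :* A) :+ ((:- S') :* (A :+ B)) := (:- S') :* B) refl (sg M) (fromℕ (x C M)) (fromℕ (x C suc M)) ⟩
    (- sg M) * fromℕ (x C suc M) ≈⟨ *-congʳ (sym (sg-suc M)) ⟩
    sg (suc M) * fromℕ (x C suc M) ∎
    where
    pascal : fromℕ (suc x C suc M) ≈ fromℕ (x C M) + fromℕ (x C suc M)
    pascal = trans (fromℕ-cong (P.sym (nCk+nC[k+1]≡[n+1]C[k+1] x M))) (fromℕ-+ (x C M) (x C suc M))

  alternating-sum : ∀ x → Σ< (λ j → sg j * fromℕ (suc x C j)) (suc (suc x)) ≈ 0#
  alternating-sum x = trans (alternating-partial-sum x (suc x))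
                            (trans (*-congˡ (fromℕ-cong (k>n⇒nCk≡0 (ℕP.n<1+n x)))) (zeroʳ _))

  module Krawtchouk (u n : ℕ) where
    q : ℕ
    q = suc u

    U Q : Carrier
    U = fromℕ u
    Q = fromℕ q

    Kn : ℕ → ℕ → Carrier
    Kn k i = K q n k i

    altBinom powBinom : ℕ → ℕ → Carrier
    altBinom x j = sg j * fromℕ (x C j)
    powBinom y m = fromℕ (u ℕ.^ m ℕ.* (y C m))

    pow-zeroℕ : ∀ y m → y ℕ.< m → u ℕ.^ m ℕ.* (y C m) ≡ 0
    pow-zeroℕ y m y<m = P.trans (P.cong (u ℕ.^ m ℕ.*_) (k>n⇒nCk≡0 y<m)) (ℕP.*-zeroʳ (u ℕ.^ m))

    altBinom-zero : ∀ x j → x ℕ.< j → altBinom x j ≈ 0#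
    altBinom-zero x j x<j = trans (*-congˡ (fromℕ-cong (k>n⇒nCk≡0 x<j))) (zeroʳ _)

    powBinom-zero : ∀ y m → y ℕ.< m → powBinom y m ≈ 0#
    powBinom-zero y m y<m = fromℕ-cong (pow-zeroℕ y m y<m)

    altBinom-step : ∀ x j → fromℕ (suc j) * altBinom x (suc j) ≈ - ((fromℕ x - fromℕ j) * altBinom x j)
    altBinom-step x j = begin
      fromℕ (suc j) * (sg (suc j) * fromℕ (x C suc j))
        ≈⟨ solve 3 (λ A B C' → A :* (B :* C') := B :* (A :* C')) refl (fromℕ (suc j)) (sg (suc j)) (fromℕ (x C suc j)) ⟩
      sg (suc j) * (fromℕ (suc j) * fromℕ (x C suc j)) ≈⟨ *-cong (sg-suc j) (sym (fromℕ-* (suc j) (x C suc j))) ⟩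
      (- sg j) * fromℕ (suc j ℕ.* (x C suc j)) ≈⟨ *-congˡ (fromℕ-cong (C-absorb x j)) ⟩
      (- sg j) * fromℕ ((x ℕ.∸ j) ℕ.* (x C j)) ≈⟨ *-congˡ (fromℕ-* (x ℕ.∸ j) (x C j)) ⟩
      (- sg j) * (fromℕ (x ℕ.∸ j) * fromℕ (x C j)) ≈⟨ *-congˡ (∸-beside x j (x C j) k>n⇒nCk≡0) ⟩
      (- sg j) * ((fromℕ x - fromℕ j) * fromℕ (x C j))
        ≈⟨ solve 4 (λ S' X' J C' → (:- S') :* ((X' :- J) :* C') := :- ((X' :- J) :* (S' :* C'))) refl (sg j) (fromℕ x) (fromℕ j) (fromℕ (x C j)) ⟩
      - ((fromℕ x - fromℕ j) * altBinom x j) ∎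

    powBinom-step : ∀ y m → fromℕ (suc m) * powBinom y (suc m) ≈ U * ((fromℕ y - fromℕ m) * powBinom y m)
    powBinom-step y m = begin
      fromℕ (suc m) * fromℕ (u ℕ.^ suc m ℕ.* (y C suc m)) ≈⟨ sym (fromℕ-* (suc m) (u ℕ.^ suc m ℕ.* (y C suc m))) ⟩
      fromℕ (suc m ℕ.* (u ℕ.^ suc m ℕ.* (y C suc m))) ≈⟨ fromℕ-cong absorbed ⟩
      fromℕ (u ℕ.* ((y ℕ.∸ m) ℕ.* (u ℕ.^ m ℕ.* (y C m))))
        ≈⟨ trans (fromℕ-* u _) (*-congˡ (fromℕ-* (y ℕ.∸ m) (u ℕ.^ m ℕ.* (y C m)))) ⟩
      U * (fromℕ (y ℕ.∸ m) * fromℕ (u ℕ.^ m ℕ.* (y C m))) ≈⟨ *-congˡ (∸-beside y m (u ℕ.^ m ℕ.* (y C m)) (pow-zeroℕ y m)) ⟩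
      U * ((fromℕ y - fromℕ m) * powBinom y m) ∎
      where
      absorbed : suc m ℕ.* (u ℕ.^ suc m ℕ.* (y C suc m)) ≡ u ℕ.* ((y ℕ.∸ m) ℕ.* (u ℕ.^ m ℕ.* (y C m)))
      absorbed = P.trans
        (solveℕ 4 (λ M U' P' C' → (conℕ 1 :+ℕ M) :*ℕ ((U' :*ℕ P') :*ℕ C') :=ℕ U' :*ℕ (P' :*ℕ ((conℕ 1 :+ℕ M) :*ℕ C')))
          P.refl m u (u ℕ.^ m) (y C suc m))
        (P.trans (P.cong (λ z → u ℕ.* (u ℕ.^ m ℕ.* z)) (C-absorb y m))
          (solveℕ 4 (λ U' P' D C' → U' :*ℕ (P' :*ℕ (D :*ℕ C')) :=ℕ U' :*ℕ (D :*ℕ (P' :*ℕ C')))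
            P.refl u (u ℕ.^ m) (y ℕ.∸ m) (y C m)))

    K-convolution : ∀ k x → Kn k x ≈ Σ< (λ j → altBinom x j * powBinom (n ℕ.∸ x) (k ℕ.∸ j)) (suc k)
    K-convolution k x = trans (fromℤ-Σ _ (suc k)) (Σ-cong′ (suc k) summand)
      where
      summand : ∀ j → fromℤ (signℤ j ℤ.* (+ (u ℕ.^ (k ℕ.∸ j) ℕ.* (x C j) ℕ.* ((n ℕ.∸ x) C (k ℕ.∸ j)))))
                       ≈ altBinom x j * powBinom (n ℕ.∸ x) (k ℕ.∸ j)
      summand j = begin
        fromℤ (signℤ j ℤ.* (+ (p ℕ.* (x C j) ℕ.* b))) ≈⟨ fromℤ-* (signℤ j) _ ⟩
        sg j * fromℕ (p ℕ.* (x C j) ℕ.* b)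
          ≈⟨ *-congˡ (fromℕ-cong (solveℕ 3 (λ P' A B → P' :*ℕ A :*ℕ B :=ℕ A :*ℕ (P' :*ℕ B)) P.refl p (x C j) b)) ⟩
        sg j * fromℕ ((x C j) ℕ.* (p ℕ.* b)) ≈⟨ *-congˡ (fromℕ-* (x C j) (p ℕ.* b)) ⟩
        sg j * (fromℕ (x C j) * powBinom (n ℕ.∸ x) (k ℕ.∸ j)) ≈⟨ sym (*-assoc _ _ _) ⟩
        altBinom x j * powBinom (n ℕ.∸ x) (k ℕ.∸ j) ∎
        where
        p b : ℕ
        p = u ℕ.^ (k ℕ.∸ j)
        b = (n ℕ.∸ x) C (k ℕ.∸ j)

    -- Coefficients of the three-term recurrence q x K_j = α K_{j+1} + β K_j + γ K_{j-1}.
    α β γ : ℕ → Carrier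
    α j = - fromℕ (suc j)
    β j = U * fromℕ n + fromℕ j * (1# - U)
    γ j = - (U * (fromℕ n - fromℕ (j ℕ.∸ 1)))

    Kprev : ℕ → ℕ → Carrier
    Kprev zero i = 0#
    Kprev (suc j) i = Kn j i

    three-term : ∀ j i → i ℕ.≤ n → Q * (fromℕ i * Kn j i) ≈ α j * Kn (suc j) i + β j * Kn j i + γ j * Kprev j i
    three-term j i i≤n = rearranged j
      where
      open ConvolutionRecurrence (altBinom i) (powBinom (n ℕ.∸ i)) (fromℕ i) (fromℕ (n ℕ.∸ i)) U
                                 (altBinom-step i) (powBinom-step (n ℕ.∸ i))
      X N : Carrier
      X = fromℕ i
      N = fromℕ n
      conv≈K : ∀ k → conv k ≈ Kn k i
      conv≈K k = sym (K-convolution k i)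
      n-i : fromℕ (n ℕ.∸ i) ≈ N - X
      n-i = fromℕ-∸ n i i≤n
      base : fromℕ 1 * Kn 1 i ≈ (U * (N - X) - X) * Kn 0 i
      base = trans (*-congˡ (sym (conv≈K 1))) (trans recurrence-base (*-cong (+-congʳ (*-congˡ n-i)) (conv≈K 0)))
      step : ∀ k → fromℕ (suc (suc k)) * Kn (suc (suc k)) i ≈
             (U * (N - X) - X + fromℕ (suc k) * (1# - U)) * Kn (suc k) i - U * (X + (N - X) - fromℕ k) * Kn k i
      step k = trans (*-congˡ (sym (conv≈K (suc (suc k))))) (trans (recurrence k)
                 (+-cong (*-cong (+-congʳ (+-congʳ (*-congˡ n-i))) (conv≈K (suc k)))
                         (-‿cong (*-cong (*-congˡ (+-congʳ (+-congˡ n-i))) (conv≈K k)))))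
      rearranged : ∀ j → Q * (X * Kn j i) ≈ α j * Kn (suc j) i + β j * Kn j i + γ j * Kprev j i
      rearranged zero = trans
        (solve 4 (λ U' X' N' K0 → (con (+ 1) :+ U') :* (X' :* K0)
            := ((:- ((((U' :* (N' :- X')) :- X')) :* K0)) :+ (((U' :* N') :+ (con (+ 0) :* (con (+ 1) :- U'))) :* K0))
               :+ ((:- (U' :* (N' :- con (+ 0)))) :* con (+ 0)))
          refl U X N (Kn 0 i))
        (sym (+-congʳ (+-congʳ (trans (sym (-‿distribˡ-* (fromℕ 1) (Kn 1 i))) (-‿cong base)))))
      rearranged (suc k) = trans
        (solve 6 (λ U' X' N' k' K0 K1 → (con (+ 1) :+ U') :* (X' :* K1)
            := ((:- (((((U' :* (N' :- X')) :- X') :+ ((con (+ 1) :+ k') :* (con (+ 1) :- U'))) :* K1)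
                      :- ((U' :* ((X' :+ (N' :- X')) :- k')) :* K0)))
                  :+ (((U' :* N') :+ ((con (+ 1) :+ k') :* (con (+ 1) :- U'))) :* K1)) :+ ((:- (U' :* (N' :- k'))) :* K0))
          refl U X N (fromℕ k) (Kn k i) (Kn (suc k) i))
        (sym (+-congʳ (+-congʳ (trans (sym (-‿distribˡ-* (fromℕ (suc (suc k))) (Kn (suc (suc k)) i))) (-‿cong (step k))))))

    K₀≈1 : ∀ i → Kn 0 i ≈ 1#
    K₀≈1 i = trans (K-convolution 0 i)
      (trans (+-identityˡ _) (trans (*-cong (*-cong fromℕ-1 fromℕ-1) fromℕ-1) (trans (*-identityʳ _) (*-identityʳ _))))

    -- K_k vanishes on {0..n} when k > n: every summand has a zero binomial.
    K-vanishes : ∀ k i → n ℕ.< k → i ℕ.≤ n → Kn k i ≈ 0#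
    K-vanishes k i n<k i≤n = trans (K-convolution k i) (Σ-0 (suc k) summand-zero)
      where
      summand-zero : ∀ j → j ℕ.< suc k → altBinom i j * powBinom (n ℕ.∸ i) (k ℕ.∸ j) ≈ 0#
      summand-zero j _ with ℕP.≤-<-connex j i
      ... | inj₁ j≤i = trans (*-congˡ (powBinom-zero (n ℕ.∸ i) (k ℕ.∸ j) lt)) (zeroʳ _)
        where
        lt : n ℕ.∸ i ℕ.< k ℕ.∸ j
        lt = ℕP.≤-<-trans (ℕP.∸-monoʳ-≤ n j≤i) (ℕP.∸-monoˡ-< n<k (ℕP.≤-trans j≤i i≤n))
      ... | inj₂ i<j = trans (*-congʳ (altBinom-zero i j i<j)) (zeroˡ _)

    -- K_k(0) = u^k C(n,k) ≥ 0.
    K-at-0-nonneg : ∀ k → 0# ≤F Kn k 0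
    K-at-0-nonneg k = ≤F-respʳ (sym (K-convolution k 0)) (Σ-nonneg (suc k) summand-nonneg)
      where
      summand-nonneg : ∀ j → j ℕ.< suc k → 0# ≤F altBinom 0 j * powBinom n (k ℕ.∸ j)
      summand-nonneg zero _ = *-nonneg (*-nonneg (fromℕ≥0 1) (fromℕ≥0 1)) (fromℕ≥0 (u ℕ.^ k ℕ.* (n C k)))
      summand-nonneg (suc j) _ = ≈0⇒≥0 (trans (*-congʳ (zeroʳ _)) (zeroˡ _))

    w : ℕ → Carrier
    w i = fromℕ ((n C i) ℕ.* u ℕ.^ i)

    w≥0 : ∀ i → 0# ≤F w i
    w≥0 i = fromℕ≥0 ((n C i) ℕ.* u ℕ.^ i)

    weightedTerm : ℕ → ℕ → ℕ → Carrier
    weightedTerm i k j = sg j * fromℕ (((n C i) ℕ.* u ℕ.^ i) ℕ.* ((i C j) ℕ.* (u ℕ.^ (k ℕ.∸ j) ℕ.* ((n ℕ.∸ i) C (k ℕ.∸ j)))))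

    weighted-K : ∀ i k → w i * Kn k i ≈ Σ< (weightedTerm i k) (suc k)
    weighted-K i k = trans (*-congˡ (K-convolution k i)) (trans (sym (Σ-*ˡ _ _ (suc k))) (Σ-cong′ (suc k) summand))
      where
      summand : ∀ j → w i * (altBinom i j * powBinom (n ℕ.∸ i) (k ℕ.∸ j)) ≈ weightedTerm i k j
      summand j = trans
        (solve 4 (λ W' S' A B → W' :* ((S' :* A) :* B) := S' :* (W' :* (A :* B))) refl
          (w i) (sg j) (fromℕ (i C j)) (powBinom (n ℕ.∸ i) (k ℕ.∸ j)))
        (*-congˡ (trans (*-congˡ (sym (fromℕ-* (i C j) _))) (sym (fromℕ-* ((n C i) ℕ.* u ℕ.^ i) _))))

    weightedTerm-sym : ∀ i k j → j ℕ.≤ i → j ℕ.≤ k →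
      ((n C i) ℕ.* u ℕ.^ i) ℕ.* ((i C j) ℕ.* (u ℕ.^ (k ℕ.∸ j) ℕ.* ((n ℕ.∸ i) C (k ℕ.∸ j)))) ≡
      ((n C k) ℕ.* u ℕ.^ k) ℕ.* ((k C j) ℕ.* (u ℕ.^ (i ℕ.∸ j) ℕ.* ((n ℕ.∸ k) C (i ℕ.∸ j))))
    weightedTerm-sym i k j j≤i j≤k =
      P.trans (regroup (n C i) (u ℕ.^ i) (i C j) (u ℕ.^ (k ℕ.∸ j)) ((n ℕ.∸ i) C (k ℕ.∸ j)))
      (P.trans (P.cong₂ ℕ._*_ (C-reciprocity n i k j j≤i j≤k) (pow-reciprocity u i k j j≤i j≤k))
      (P.sym (regroup (n C k) (u ℕ.^ k) (k C j) (u ℕ.^ (i ℕ.∸ j)) ((n ℕ.∸ k) C (i ℕ.∸ j)))))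
      where
      regroup : ∀ a b c d e → (a ℕ.* b) ℕ.* (c ℕ.* (d ℕ.* e)) ≡ (a ℕ.* (c ℕ.* e)) ℕ.* (b ℕ.* d)
      regroup = solveℕ 5 (λ A B C' D E → (A :*ℕ B) :*ℕ (C' :*ℕ (D :*ℕ E)) :=ℕ (A :*ℕ (C' :*ℕ E)) :*ℕ (B :*ℕ D)) P.refl

    -- Reciprocity w_i K_k(i) = w_k K_i(k), first for i ≤ k (the summands of
    -- index j > i vanish), then in general.
    reciprocity-≤ : ∀ i k → i ℕ.≤ k → w i * Kn k i ≈ w k * Kn i k
    reciprocity-≤ i k i≤k = begin
      w i * Kn k i ≈⟨ weighted-K i k ⟩
      Σ< (weightedTerm i k) (suc k) ≈⟨ Σ-trunc (suc i) (suc k) (s≤s i≤k) beyond-i ⟩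
      Σ< (weightedTerm i k) (suc i)
        ≈⟨ Σ-cong (suc i) (λ j j<i → *-congˡ (fromℕ-cong
             (weightedTerm-sym i k j (ℕP.≤-pred j<i) (ℕP.≤-trans (ℕP.≤-pred j<i) i≤k)))) ⟩
      Σ< (weightedTerm k i) (suc i) ≈⟨ sym (weighted-K k i) ⟩
      w k * Kn i k ∎
      where
      beyond-i : ∀ j → suc i ℕ.≤ j → j ℕ.< suc k → weightedTerm i k j ≈ 0#
      beyond-i j i<j _ = trans (*-congˡ (fromℕ-cong (P.trans
        (P.cong (λ c → ((n C i) ℕ.* u ℕ.^ i) ℕ.* (c ℕ.* (u ℕ.^ (k ℕ.∸ j) ℕ.* ((n ℕ.∸ i) C (k ℕ.∸ j))))) (k>n⇒nCk≡0 i<j))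
        (ℕP.*-zeroʳ ((n C i) ℕ.* u ℕ.^ i))))) (zeroʳ _)

    reciprocity : ∀ i k → w i * Kn k i ≈ w k * Kn i k
    reciprocity i k with ℕP.≤-total i k
    ... | inj₁ i≤k = reciprocity-≤ i k i≤k
    ... | inj₂ k≤i = sym (reciprocity-≤ k i k≤i)

    -- Column sums: Σ_{k ≤ n} K_k(x) = 0 for 1 ≤ x ≤ n.  Regrouping the double
    -- sum of the convolution leaves (Σ_j (-1)^j C(x,j)) (Σ_m u^m C(n-x,m)).
    column-sum : ∀ x → 1 ℕ.≤ x → x ℕ.≤ n → Σ< (λ k → Kn k x) (suc n) ≈ 0#
    column-sum (suc x) (s≤s _) x≤n = begin
      Σ< (λ k → Kn k X) (suc n) ≈⟨ Σ-cong′ (suc n) (λ k → K-convolution k X) ⟩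
      Σ< (λ k → Σ< (λ j → altBinom X j * powBinom y (k ℕ.∸ j)) (suc k)) (suc n)
        ≈⟨ Σ-triangle (λ j m → altBinom X j * powBinom y m) (suc n) ⟩
      Σ< (λ j → Σ< (λ m → altBinom X j * powBinom y m) (suc n ℕ.∸ j)) (suc n) ≈⟨ Σ-cong (suc n) row ⟩
      Σ< (λ j → altBinom X j * powSum) (suc n) ≈⟨ Σ-*ʳ powSum (altBinom X) (suc n) ⟩
      Σ< (altBinom X) (suc n) * powSum ≈⟨ *-congʳ (Σ-trunc (suc X) (suc n) (s≤s x≤n) (λ j X<j _ → altBinom-zero X j X<j)) ⟩
      Σ< (altBinom X) (suc X) * powSum ≈⟨ *-congʳ (alternating-sum x) ⟩
      0# * powSum ≈⟨ zeroˡ powSum ⟩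
      0# ∎
      where
      X y : ℕ
      X = suc x
      y = n ℕ.∸ X
      powSum : Carrier
      powSum = Σ< (powBinom y) (suc y)
      row : ∀ j → j ℕ.< suc n → Σ< (λ m → altBinom X j * powBinom y m) (suc n ℕ.∸ j) ≈ altBinom X j * powSum
      row j j<n with ℕP.≤-<-connex j X
      ... | inj₂ X<j = trans (Σ-0 (suc n ℕ.∸ j) (λ m _ → trans (*-congʳ (altBinom-zero X j X<j)) (zeroˡ (powBinom y m))))
                             (sym (trans (*-congʳ (altBinom-zero X j X<j)) (zeroˡ _)))
      ... | inj₁ j≤X = trans (Σ-*ˡ (altBinom X j) (powBinom y) (suc n ℕ.∸ j))
                             (*-congˡ (Σ-trunc (suc y) (suc n ℕ.∸ j) long-enough (λ m y<m _ → powBinom-zero y m y<m)))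
        where
        long-enough : suc y ℕ.≤ suc n ℕ.∸ j
        long-enough = ℕP.≤-trans (s≤s (ℕP.∸-monoʳ-≤ n j≤X)) (ℕP.≤-reflexive (P.sym (ℕP.+-∸-assoc 1 (ℕP.≤-pred j<n))))

  -- Here q ≥ 2, i.e. u ≥ 1, so that γ_{j+1} = -u (n - j) is nonzero for j < n.
  module Orthogonality (u n : ℕ) (u≥1 : 1 ℕ.≤ u) where
    open Krawtchouk u n public

    inner : (ℕ → Carrier) → (ℕ → Carrier) → Carrier
    inner f g = Σ< (λ i → w i * (f i * g i)) (suc n)

    inner-zero : ∀ g → inner (λ _ → 0#) g ≈ 0#
    inner-zero g = Σ-0 (suc n) (λ i _ → trans (*-congˡ (zeroˡ (g i))) (zeroʳ _))

    Expansion : (ℕ → Carrier) → (ℕ → Carrier) → Set ℓ₁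
    Expansion g e = IsKExpansion q n g e

    gram gramPrev gramPrev′ : ℕ → ℕ → Carrier
    gram j l = inner (Kn j) (Kn l)
    gramPrev j l = inner (Kprev j) (Kn l)
    gramPrev′ j l = inner (Kn j) (Kprev l)

    gram-sym : ∀ j l → gram j l ≈ gram l j
    gram-sym j l = Σ-cong′ (suc n) (λ i → *-congˡ (*-comm _ _))

    -- ⟨K_0,K_l⟩ = Σ_i w_i K_l(i) = w_l Σ_i K_i(l) = 0 for l ≥ 1, by
    -- reciprocity and the column sums (and trivially for l > n).
    gram-0-l : ∀ l → 1 ℕ.≤ l → gram 0 l ≈ 0#
    gram-0-l l 1≤l = trans (Σ-cong′ (suc n) (λ i → *-congˡ (trans (*-congʳ (K₀≈1 i)) (*-identityˡ _)))) weighted-sum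
      where
      weighted-sum : Σ< (λ i → w i * Kn l i) (suc n) ≈ 0#
      weighted-sum with ℕP.≤-<-connex l n
      ... | inj₁ l≤n = begin
        Σ< (λ i → w i * Kn l i) (suc n) ≈⟨ Σ-cong′ (suc n) (λ i → reciprocity i l) ⟩
        Σ< (λ i → w l * Kn i l) (suc n) ≈⟨ Σ-*ˡ (w l) (λ i → Kn i l) (suc n) ⟩
        w l * Σ< (λ i → Kn i l) (suc n) ≈⟨ *-congˡ (column-sum l 1≤l l≤n) ⟩
        w l * 0# ≈⟨ zeroʳ _ ⟩
        0# ∎
      ... | inj₂ n<l = Σ-0 (suc n) (λ i i<n → trans (*-congˡ (K-vanishes l i n<l (ℕP.≤-pred i<n))) (zeroʳ _))

    shift-left : ∀ j l → Σ< (λ i → w i * ((Q * (fromℕ i * Kn j i)) * Kn l i)) (suc n)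
                         ≈ α j * gram (suc j) l + β j * gram j l + γ j * gramPrev j l
    shift-left j l = begin
      Σ< (λ i → w i * ((Q * (fromℕ i * Kn j i)) * Kn l i)) (suc n)
        ≈⟨ Σ-cong (suc n) (λ i i<n → *-congˡ (*-congʳ (three-term j i (ℕP.≤-pred i<n)))) ⟩
      Σ< (λ i → w i * ((α j * Kn (suc j) i + β j * Kn j i + γ j * Kprev j i) * Kn l i)) (suc n)
        ≈⟨ Σ-cong′ (suc n) (λ i →
             solve 8 (λ W' A B Cc K1 K' Km Kl → W' :* ((((A :* K1) :+ (B :* K')) :+ (Cc :* Km)) :* Kl)
                       := ((A :* (W' :* (K1 :* Kl))) :+ (B :* (W' :* (K' :* Kl)))) :+ (Cc :* (W' :* (Km :* Kl)))) refl
                    (w i) (α j) (β j) (γ j) (Kn (suc j) i) (Kn j i) (Kprev j i) (Kn l i)) ⟩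
      Σ< (λ i → (α j * (w i * (Kn (suc j) i * Kn l i)) + β j * (w i * (Kn j i * Kn l i)))
                + γ j * (w i * (Kprev j i * Kn l i))) (suc n)
        ≈⟨ trans (Σ-+ _ _ (suc n)) (+-cong (trans (Σ-+ _ _ (suc n)) (+-cong (Σ-*ˡ _ _ (suc n)) (Σ-*ˡ _ _ (suc n))))
                                           (Σ-*ˡ _ _ (suc n))) ⟩
      α j * gram (suc j) l + β j * gram j l + γ j * gramPrev j l ∎

    shift-right : ∀ j l → Σ< (λ i → w i * (Kn j i * (Q * (fromℕ i * Kn l i)))) (suc n)
                          ≈ α l * gram j (suc l) + β l * gram j l + γ l * gramPrev′ j l
    shift-right j l = begin
      Σ< (λ i → w i * (Kn j i * (Q * (fromℕ i * Kn l i)))) (suc n)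
        ≈⟨ Σ-cong (suc n) (λ i i<n → *-congˡ (*-congˡ (three-term l i (ℕP.≤-pred i<n)))) ⟩
      Σ< (λ i → w i * (Kn j i * (α l * Kn (suc l) i + β l * Kn l i + γ l * Kprev l i))) (suc n)
        ≈⟨ Σ-cong′ (suc n) (λ i →
             solve 8 (λ W' A B Cc K1 K' Km Kj → W' :* (Kj :* (((A :* K1) :+ (B :* K')) :+ (Cc :* Km)))
                       := ((A :* (W' :* (Kj :* K1))) :+ (B :* (W' :* (Kj :* K')))) :+ (Cc :* (W' :* (Kj :* Km)))) refl
                    (w i) (α l) (β l) (γ l) (Kn (suc l) i) (Kn l i) (Kprev l i) (Kn j i)) ⟩
      Σ< (λ i → (α l * (w i * (Kn j i * Kn (suc l) i)) + β l * (w i * (Kn j i * Kn l i)))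
                + γ l * (w i * (Kn j i * Kprev l i))) (suc n)
        ≈⟨ trans (Σ-+ _ _ (suc n)) (+-cong (trans (Σ-+ _ _ (suc n)) (+-cong (Σ-*ˡ _ _ (suc n)) (Σ-*ˡ _ _ (suc n))))
                                           (Σ-*ˡ _ _ (suc n))) ⟩
      α l * gram j (suc l) + β l * gram j l + γ l * gramPrev′ j l ∎

    -- Multiplication by x is self-adjoint, so the two expansions agree;
    -- solved for ⟨K_{j+1},K_l⟩ this is a recursion for the Gram matrix.
    gram-step : ∀ j l → α j * gram (suc j) l
                        ≈ ((α l * gram j (suc l) + (β l - β j) * gram j l) + γ l * gramPrev′ j l) - γ j * gramPrev j l
    gram-step j l = begin
      α j * gram (suc j) l
        ≈⟨ solve 6 (λ A B Cc G1 G0 Gm0 → A :* G1 := (((A :* G1) :+ (B :* G0)) :+ (Cc :* Gm0)) :- (B :* G0) :- (Cc :* Gm0))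
             refl (α j) (β j) (γ j) (gram (suc j) l) (gram j l) (gramPrev j l) ⟩
      (((α j * gram (suc j) l) + (β j * gram j l)) + (γ j * gramPrev j l)) - β j * gram j l - γ j * gramPrev j l
        ≈⟨ +-congʳ (+-congʳ self-adjoint) ⟩
      ((α l * gram j (suc l) + β l * gram j l) + γ l * gramPrev′ j l) - β j * gram j l - γ j * gramPrev j l
        ≈⟨ solve 9 (λ A' B' Cc' B Cc G1 G0 Gm1 Gm0 → (((A' :* G1) :+ (B' :* G0)) :+ (Cc' :* Gm1)) :- (B :* G0) :- (Cc :* Gm0)
               := (((A' :* G1) :+ ((B' :- B) :* G0)) :+ (Cc' :* Gm1)) :- (Cc :* Gm0)) refl
             (α l) (β l) (γ l) (β j) (γ j) (gram j (suc l)) (gram j l) (gramPrev′ j l) (gramPrev j l) ⟩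
      ((α l * gram j (suc l) + (β l - β j) * gram j l) + γ l * gramPrev′ j l) - γ j * gramPrev j l ∎
      where
      self-adjoint : α j * gram (suc j) l + β j * gram j l + γ j * gramPrev j l
                     ≈ α l * gram j (suc l) + β l * gram j l + γ l * gramPrev′ j l
      self-adjoint = trans (sym (shift-left j l)) (trans (Σ-cong′ (suc n) (λ i → *-congˡ
        (solve 4 (λ Q' X' A B → (Q' :* (X' :* A)) :* B := A :* (Q' :* (X' :* B))) refl Q (fromℕ i) (Kn j i) (Kn l i))))
        (shift-right j l))

    α≉0 : ∀ j → ¬ (α j ≈ 0#)
    α≉0 j = neg≉0 (fromℕ-suc≉0 j)

    gram-off-step : ∀ j l → gram j (suc (suc l)) ≈ 0# → gram j (suc l) ≈ 0# → gram j l ≈ 0# →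
                    gramPrev j (suc l) ≈ 0# → gram (suc j) (suc l) ≈ 0#
    gram-off-step j l e₁ e₂ e₃ e₄ = zero-prod (α≉0 j) (trans (gram-step j (suc l)) all-zero)
      where
      all-zero : ((α (suc l) * gram j (suc (suc l)) + (β (suc l) - β j) * gram j (suc l)) + γ (suc l) * gram j l)
                 - γ j * gramPrev j (suc l) ≈ 0#
      all-zero = trans (+-cong (+-cong (+-cong (*-congˡ e₁) (*-congˡ e₂)) (*-congˡ e₃)) (-‿cong (*-congˡ e₄)))
        (solve 4 (λ A B Cc D → (((A :* con (+ 0)) :+ (B :* con (+ 0))) :+ (Cc :* con (+ 0))) :- (D :* con (+ 0)) := con (+ 0))
           refl (α (suc l)) (β (suc l) - β j) (γ (suc l)) (γ j))

    gram-upper : ∀ j l → j ℕ.< l → gram j l ≈ 0#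
    gram-upper zero l 0<l = gram-0-l l 0<l
    gram-upper (suc zero) (suc l) (s≤s 0<l) =
      gram-off-step 0 l (gram-upper 0 (suc (suc l)) (s≤s z≤n)) (gram-upper 0 (suc l) (s≤s z≤n))
                        (gram-upper 0 l 0<l) (inner-zero _)
    gram-upper (suc (suc j)) (suc l) (s≤s sj<l) = gram-off-step (suc j) l
      (gram-upper (suc j) (suc (suc l)) (ℕP.≤-trans sj<l (ℕP.≤-trans (ℕP.n≤1+n l) (ℕP.n≤1+n (suc l)))))
      (gram-upper (suc j) (suc l) (ℕP.≤-trans sj<l (ℕP.n≤1+n l)))
      (gram-upper (suc j) l sj<l)
      (gram-upper j (suc l) (ℕP.≤-trans (ℕP.n≤1+n (suc j)) (ℕP.≤-trans sj<l (ℕP.n≤1+n l))))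

    orthogonal : ∀ j l → ¬ (j ≡ l) → gram j l ≈ 0#
    orthogonal j l j≢l with ℕP.<-cmp j l
    ... | tri< j<l _ _ = gram-upper j l j<l
    ... | tri≈ _ j≡l _ = ⊥-elim (j≢l j≡l)
    ... | tri> _ _ l<j = trans (gram-sym j l) (gram-upper l j l<j)

    normSq : ℕ → Carrier
    normSq j = gram j j

    normSq≥0 : ∀ j → 0# ≤F normSq j
    normSq≥0 j = Σ-nonneg (suc n) (λ i _ → *-nonneg (w≥0 i) (sq≥0 (Kn j i)))

    normSq₀≥1 : 1# ≤F normSq 0
    normSq₀≥1 = ≤F-respˡ term₀≈1 (Σ-≥term (suc n) 0 (s≤s z≤n) (λ i _ → *-nonneg (w≥0 i) (sq≥0 (Kn 0 i))))
      where
      term₀≈1 : w 0 * (Kn 0 0 * Kn 0 0) ≈ 1#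
      term₀≈1 = trans (*-cong fromℕ-1 (*-cong (K₀≈1 0) (K₀≈1 0))) (trans (*-identityˡ _) (*-identityˡ _))

    γ≉0 : ∀ j → j ℕ.< n → ¬ (γ (suc j) ≈ 0#)
    γ≉0 j j<n = neg≉0 (prod≉0 (fromℕ≉0 u (λ u≡0 → ℕP.<⇒≢ u≥1 (P.sym u≡0)))
      (λ e → fromℕ≉0 (n ℕ.∸ j) (λ n∸j≡0 → ℕP.<⇒≢ (ℕP.m<n⇒0<n∸m j<n) (P.sym n∸j≡0))
                     (trans (fromℕ-∸ n j (ℕP.<⇒≤ j<n)) e)))

    gramPrev-diag : ∀ j → gramPrev j (suc j) ≈ 0#
    gramPrev-diag zero = inner-zero _
    gramPrev-diag (suc j) = gram-upper j (suc (suc j)) (ℕP.n≤1+n (suc j))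

    -- ⟨K_j,K_j⟩ ≠ 0 for j ≤ n: gram-step at l = j + 1 gives
    -- α_j ⟨K_{j+1},K_{j+1}⟩ = γ_{j+1} ⟨K_j,K_j⟩, with α_j, γ_{j+1} ≠ 0.
    normSq≉0 : ∀ j → j ℕ.≤ n → ¬ (normSq j ≈ 0#)
    normSq≉0 zero _ e = 0≉1 (sym (antisym (≤F-respʳ e normSq₀≥1) 0≤1))
    normSq≉0 (suc j) sj≤n e = normSq≉0 j (ℕP.<⇒≤ sj≤n) (zero-prod (γ≉0 j sj≤n) γnormSq≈0)
      where
      γnormSq≈0 : γ (suc j) * normSq j ≈ 0#
      γnormSq≈0 = begin
        γ (suc j) * normSq j
          ≈⟨ solve 5 (λ A B Cc D Q' → Cc :* D := ((A :* con (+ 0) :+ B :* con (+ 0)) :+ Cc :* D) :- (Q' :* con (+ 0)))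
               refl (α (suc j)) (β (suc j) - β j) (γ (suc j)) (normSq j) (γ j) ⟩
        ((α (suc j) * 0# + (β (suc j) - β j) * 0#) + γ (suc j) * normSq j) - γ j * 0#
          ≈⟨ sym (+-cong (+-cong (+-cong (*-congˡ (gram-upper j (suc (suc j)) (ℕP.n≤1+n (suc j))))
                                         (*-congˡ (gram-upper j (suc j) (ℕP.n<1+n j)))) refl)
                         (-‿cong (*-congˡ (gramPrev-diag j)))) ⟩
        ((α (suc j) * gram j (suc (suc j)) + (β (suc j) - β j) * gram j (suc j)) + γ (suc j) * normSq j)
          - γ j * gramPrev j (suc j) ≈⟨ sym (gram-step j (suc j)) ⟩
        α j * normSq (suc j) ≈⟨ *-congˡ e ⟩
        α j * 0# ≈⟨ zeroʳ _ ⟩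
        0# ∎

    inner-with-K : ∀ (f cs : ℕ → Carrier) → Expansion f cs →
                   ∀ l → l ℕ.≤ n → inner f (Kn l) ≈ cs l * normSq l
    inner-with-K f cs hyp l l≤n = begin
      inner f (Kn l) ≈⟨ Σ-cong (suc n) (λ i i<n → *-congˡ (*-congʳ (hyp i (ℕP.≤-pred i<n)))) ⟩
      Σ< (λ i → w i * (Σ< (λ j → cs j * Kn j i) (suc n) * Kn l i)) (suc n) ≈⟨ Σ-cong′ (suc n) distribute ⟩
      Σ< (λ i → Σ< (λ j → cs j * (w i * (Kn j i * Kn l i))) (suc n)) (suc n) ≈⟨ Σ-swap _ (suc n) (suc n) ⟩
      Σ< (λ j → Σ< (λ i → cs j * (w i * (Kn j i * Kn l i))) (suc n)) (suc n) ≈⟨ Σ-cong′ (suc n) (λ j → Σ-*ˡ (cs j) _ (suc n)) ⟩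
      Σ< (λ j → cs j * gram j l) (suc n)
        ≈⟨ Σ-delta (suc n) l (s≤s l≤n) (λ j _ j≢l → trans (*-congˡ (orthogonal j l j≢l)) (zeroʳ _)) ⟩
      cs l * normSq l ∎
      where
      distribute : ∀ i → w i * (Σ< (λ j → cs j * Kn j i) (suc n) * Kn l i)
                         ≈ Σ< (λ j → cs j * (w i * (Kn j i * Kn l i))) (suc n)
      distribute i = begin
        w i * (Σ< (λ j → cs j * Kn j i) (suc n) * Kn l i) ≈⟨ *-congˡ (sym (Σ-*ʳ (Kn l i) _ (suc n))) ⟩
        w i * Σ< (λ j → cs j * Kn j i * Kn l i) (suc n) ≈⟨ sym (Σ-*ˡ (w i) _ (suc n)) ⟩
        Σ< (λ j → w i * (cs j * Kn j i * Kn l i)) (suc n)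
          ≈⟨ Σ-cong′ (suc n) (λ j → solve 4 (λ W' Cc A B → W' :* (Cc :* A :* B) := Cc :* (W' :* (A :* B)))
                                       refl (w i) (cs j) (Kn j i) (Kn l i)) ⟩
        Σ< (λ j → cs j * (w i * (Kn j i * Kn l i))) (suc n) ∎

    coefficient-formula : ∀ (f cs : ℕ → Carrier) → Expansion f cs →
                          ∀ l → l ℕ.≤ n → cs l ≈ normSq l ⁻¹ * inner f (Kn l)
    coefficient-formula f cs hyp l l≤n = mul-cancelˡ (normSq≉0 l l≤n) (begin
      normSq l * cs l ≈⟨ *-comm _ _ ⟩
      cs l * normSq l ≈⟨ sym (inner-with-K f cs hyp l l≤n) ⟩
      inner f (Kn l) ≈⟨ sym (*-identityˡ _) ⟩
      1# * inner f (Kn l) ≈⟨ *-congʳ (sym (inv-r (normSq≉0 l l≤n))) ⟩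
      (normSq l * normSq l ⁻¹) * inner f (Kn l) ≈⟨ *-assoc _ _ _ ⟩
      normSq l * (normSq l ⁻¹ * inner f (Kn l)) ∎)

  -- Degree bookkeeping for K-expansions: multiplying by a linear factor
  -- (A - x) raises the degree by one and scales the top coefficient by
  -- (d+1)/q > 0.
  module KExpansion (u n : ℕ) (u≥1 : 1 ℕ.≤ u) where
    open Orthogonality u n u≥1 public

    DegreeBound : (ℕ → Carrier) → ℕ → Set ℓ₁
    DegreeBound e d = ∀ j → d ℕ.< j → e j ≈ 0#

    expansion-cong : ∀ {g g′} e → Expansion g e → (∀ i → i ℕ.≤ n → g′ i ≈ g i) → Expansion g′ e
    expansion-cong e ex g′≈g i i≤n = trans (g′≈g i i≤n) (ex i i≤n)

    unit : ℕ → ℕ → Carrier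
    unit k j with j ℕ.≟ k
    ... | yes _ = 1#
    ... | no _ = 0#

    unit-same : ∀ k → unit k k ≈ 1#
    unit-same k with k ℕ.≟ k
    ... | yes _ = refl
    ... | no k≢k = ⊥-elim (k≢k P.refl)

    unit-diff : ∀ k j → ¬ (j ≡ k) → unit k j ≈ 0#
    unit-diff k j j≢k with j ℕ.≟ k
    ... | yes j≡k = ⊥-elim (j≢k j≡k)
    ... | no _ = refl

    expansion-K : ∀ k → k ℕ.≤ n → Expansion (Kn k) (unit k)
    expansion-K k k≤n i i≤n = sym (trans
      (Σ-delta (suc n) k (s≤s k≤n) (λ j _ j≢k → trans (*-congʳ (unit-diff k j j≢k)) (zeroˡ _)))
      (trans (*-congʳ (unit-same k)) (*-identityˡ _)))

    degree-unit : ∀ k → DegreeBound (unit k) k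
    degree-unit k j k<j = unit-diff k j (λ j≡k → ℕP.<⇒≢ k<j (P.sym j≡k))

    Q≉0 : ¬ (Q ≈ 0#)
    Q≉0 = fromℕ-suc≉0 u

    q⁻¹ : Carrier
    q⁻¹ = Q ⁻¹

    q⁻¹≥0 : 0# ≤F q⁻¹
    q⁻¹≥0 = inv≥0 (fromℕ≥0 (suc u)) Q≉0

    x·K : ∀ j i → i ℕ.≤ n → fromℕ i * Kn j i ≈ q⁻¹ * (α j * Kn (suc j) i + β j * Kn j i + γ j * Kprev j i)
    x·K j i i≤n = begin
      fromℕ i * Kn j i ≈⟨ sym (*-identityˡ _) ⟩
      1# * (fromℕ i * Kn j i) ≈⟨ *-congʳ (sym (inv-l Q≉0)) ⟩
      (q⁻¹ * Q) * (fromℕ i * Kn j i) ≈⟨ *-assoc _ _ _ ⟩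
      q⁻¹ * (Q * (fromℕ i * Kn j i)) ≈⟨ *-congˡ (three-term j i i≤n) ⟩
      q⁻¹ * (α j * Kn (suc j) i + β j * Kn j i + γ j * Kprev j i) ∎

    shiftUp : (ℕ → Carrier) → ℕ → Carrier
    shiftUp c zero = 0#
    shiftUp c (suc j) = c j

    -- Σ_j c_j K_{j+1}(i) = Σ_j c_{j-1} K_j(i), since K_{n+1} vanishes on 0..n.
    reindex-up : ∀ (c : ℕ → Carrier) i → i ℕ.≤ n →
      Σ< (λ j → c j * Kn (suc j) i) (suc n) ≈ Σ< (λ j → shiftUp c j * Kn j i) (suc n)
    reindex-up c i i≤n = begin
      Σ< (λ j → c j * Kn (suc j) i) (suc n) ≈⟨ sym (+-identityˡ _) ⟩
      0# + Σ< (λ j → c j * Kn (suc j) i) (suc n) ≈⟨ +-congʳ (sym (zeroˡ (Kn 0 i))) ⟩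
      shiftUp c 0 * Kn 0 i + Σ< (λ j → c j * Kn (suc j) i) (suc n) ≈⟨ sym (Σ-shift (λ j → shiftUp c j * Kn j i) (suc n)) ⟩
      Σ< (λ j → shiftUp c j * Kn j i) (suc n) + c n * Kn (suc n) i
        ≈⟨ +-congˡ (trans (*-congˡ (K-vanishes (suc n) i (ℕP.n<1+n n) i≤n)) (zeroʳ _)) ⟩
      Σ< (λ j → shiftUp c j * Kn j i) (suc n) + 0# ≈⟨ +-identityʳ _ ⟩
      Σ< (λ j → shiftUp c j * Kn j i) (suc n) ∎

    reindex-down : ∀ (c : ℕ → Carrier) i → c (suc n) ≈ 0# →
      Σ< (λ j → c j * Kprev j i) (suc n) ≈ Σ< (λ j → c (suc j) * Kn j i) (suc n)
    reindex-down c i cₙ₊₁≈0 = begin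
      Σ< (λ j → c j * Kprev j i) (suc n) ≈⟨ Σ-shift _ n ⟩
      c 0 * 0# + Σ< (λ j → c (suc j) * Kn j i) n ≈⟨ trans (+-congʳ (zeroʳ _)) (+-identityˡ _) ⟩
      Σ< (λ j → c (suc j) * Kn j i) n ≈⟨ sym (+-identityʳ _) ⟩
      Σ< (λ j → c (suc j) * Kn j i) n + 0# ≈⟨ +-congˡ (sym (trans (*-congʳ cₙ₊₁≈0) (zeroˡ _))) ⟩
      Σ< (λ j → c (suc j) * Kn j i) (suc n) ∎

    mulLinear : Carrier → (ℕ → Carrier) → ℕ → Carrier
    mulLinear A e j = e j * (A - q⁻¹ * β j) - shiftUp (λ k → q⁻¹ * (α k * e k)) j - q⁻¹ * (γ (suc j) * e (suc j))

    -- γ_{n+1} = 0, so no K_n-coefficient leaks in from index n + 1.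
    γ-beyond-n : γ (suc n) ≈ 0#
    γ-beyond-n = trans (-‿cong (trans (*-congˡ (-‿inverseʳ (fromℕ n))) (zeroʳ U))) -0#≈0#

    expansion-mulLinear : ∀ (a : ℕ) (g e : ℕ → Carrier) → Expansion g e →
                          Expansion (λ x → (fromℕ a - fromℕ x) * g x) (mulLinear (fromℕ a) e)
    expansion-mulLinear a g e ex i i≤n = begin
      (A - X) * g i ≈⟨ *-congˡ (ex i i≤n) ⟩
      (A - X) * Σ< (λ j → e j * Kn j i) (suc n) ≈⟨ sym (Σ-*ˡ _ _ (suc n)) ⟩
      Σ< (λ j → (A - X) * (e j * Kn j i)) (suc n) ≈⟨ Σ-cong′ (suc n) by-recurrence ⟩
      Σ< (λ j → diag j * Kn j i - up j * Kn (suc j) i - down j * Kprev j i) (suc n) ≈⟨ Σ-sub₂ _ _ _ (suc n) ⟩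
      Σ< (λ j → diag j * Kn j i) (suc n) - Σ< (λ j → up j * Kn (suc j) i) (suc n) - Σ< (λ j → down j * Kprev j i) (suc n)
        ≈⟨ +-cong (+-congˡ (-‿cong (reindex-up up i i≤n))) (-‿cong (reindex-down down i down-last)) ⟩
      Σ< (λ j → diag j * Kn j i) (suc n) - Σ< (λ j → shiftUp up j * Kn j i) (suc n) - Σ< (λ j → down (suc j) * Kn j i) (suc n)
        ≈⟨ sym (trans (Σ-cong′ (suc n) (λ j → distrib₂ (diag j) (shiftUp up j) (down (suc j)) (Kn j i))) (Σ-sub₂ _ _ _ (suc n))) ⟩
      Σ< (λ j → mulLinear A e j * Kn j i) (suc n) ∎
      where
      A X : Carrier
      A = fromℕ a
      X = fromℕ i
      diag up down : ℕ → Carrier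
      diag j = e j * (A - q⁻¹ * β j)
      up j = q⁻¹ * (α j * e j)
      down j = q⁻¹ * (γ j * e j)
      down-last : down (suc n) ≈ 0#
      down-last = trans (*-congˡ (trans (*-congʳ γ-beyond-n) (zeroˡ _))) (zeroʳ q⁻¹)
      distrib₂ : ∀ p r t k → (p - r - t) * k ≈ p * k - r * k - t * k
      distrib₂ = solve 4 (λ P R T K′ → ((P :- R) :- T) :* K′ := ((P :* K′) :- (R :* K′)) :- (T :* K′)) refl
      by-recurrence : ∀ j → (A - X) * (e j * Kn j i) ≈ diag j * Kn j i - up j * Kn (suc j) i - down j * Kprev j i
      by-recurrence j = begin
        (A - X) * (e j * Kn j i)
          ≈⟨ solve 4 (λ A' X' E K' → (A' :- X') :* (E :* K') := (A' :* (E :* K')) :- (E :* (X' :* K'))) refl A X (e j) (Kn j i) ⟩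
        A * (e j * Kn j i) - e j * (X * Kn j i) ≈⟨ +-congˡ (-‿cong (*-congˡ (x·K j i i≤n))) ⟩
        A * (e j * Kn j i) - e j * (q⁻¹ * (α j * Kn (suc j) i + β j * Kn j i + γ j * Kprev j i))
          ≈⟨ solve 9 (λ A' E K' Q' Al Be Ga K1 Km →
                        (A' :* (E :* K')) :- (E :* (Q' :* (((Al :* K1) :+ (Be :* K')) :+ (Ga :* Km))))
                        := (((E :* (A' :- (Q' :* Be))) :* K') :- ((Q' :* (Al :* E)) :* K1)) :- ((Q' :* (Ga :* E)) :* Km))
               refl A (e j) (Kn j i) q⁻¹ (α j) (β j) (γ j) (Kn (suc j) i) (Kprev j i) ⟩
        diag j * Kn j i - up j * Kn (suc j) i - down j * Kprev j i ∎

    degree-mulLinear : ∀ A e d → DegreeBound e d → DegreeBound (mulLinear A e) (suc d)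
    degree-mulLinear A e d dg j d+1<j = begin
      e j * (A - q⁻¹ * β j) - shiftUp (λ k → q⁻¹ * (α k * e k)) j - q⁻¹ * (γ (suc j) * e (suc j))
        ≈⟨ +-cong (+-cong (*-congʳ (dg j d<j)) (-‿cong (up-zero j d+1<j))) (-‿cong (*-congˡ (*-congˡ (dg (suc j) d<j+1)))) ⟩
      0# * (A - q⁻¹ * β j) - 0# - q⁻¹ * (γ (suc j) * 0#)
        ≈⟨ solve 3 (λ P' Q' G' → (con (+ 0) :* P') :- con (+ 0) :- (Q' :* (G' :* con (+ 0))) := con (+ 0))
             refl (A - q⁻¹ * β j) q⁻¹ (γ (suc j)) ⟩
      0# ∎
      where
      d<j : d ℕ.< j
      d<j = ℕP.<-trans (ℕP.n<1+n d) d+1<j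
      d<j+1 : d ℕ.< suc j
      d<j+1 = ℕP.<-trans d<j (ℕP.n<1+n j)
      up-zero : ∀ j → suc d ℕ.< j → shiftUp (λ k → q⁻¹ * (α k * e k)) j ≈ 0#
      up-zero (suc j) (s≤s d<j) = trans (*-congˡ (trans (*-congˡ (dg j d<j)) (zeroʳ _))) (zeroʳ _)

    -- … and the new top coefficient is (d+1)/q times the old one.
    leading-mulLinear : ∀ A e d → DegreeBound e d → 0# ≤F e d → 0# ≤F mulLinear A e (suc d)
    leading-mulLinear A e d dg top≥0 = ≤F-respʳ (sym new-top) (*-nonneg q⁻¹≥0 (*-nonneg (fromℕ≥0 (suc d)) top≥0))
      where
      new-top : mulLinear A e (suc d) ≈ q⁻¹ * (fromℕ (suc d) * e d)
      new-top = begin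
        e (suc d) * (A - q⁻¹ * β (suc d)) - q⁻¹ * (α d * e d) - q⁻¹ * (γ (suc (suc d)) * e (suc (suc d)))
          ≈⟨ +-cong (+-congʳ (*-congʳ (dg (suc d) (ℕP.n<1+n d))))
                    (-‿cong (*-congˡ (*-congˡ (dg (suc (suc d)) (ℕP.<-trans (ℕP.n<1+n d) (ℕP.n<1+n (suc d))))))) ⟩
        0# * (A - q⁻¹ * β (suc d)) - q⁻¹ * (- fromℕ (suc d) * e d) - q⁻¹ * (γ (suc (suc d)) * 0#)
          ≈⟨ solve 5 (λ P' Q' S' E G' → ((con (+ 0) :* P') :- (Q' :* ((:- S') :* E))) :- (Q' :* (G' :* con (+ 0))) := Q' :* (S' :* E))
               refl (A - q⁻¹ * β (suc d)) q⁻¹ (fromℕ (suc d)) (e d) (γ (suc (suc d))) ⟩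
        q⁻¹ * (fromℕ (suc d) * e d) ∎

    record TimesH {s} (a : Fin s → ℕ) (g e : ℕ → Carrier) (d : ℕ) : Set (c ⊔ ℓ₁ ⊔ ℓ₂) where
      field
        coeff   : ℕ → Carrier
        expands : Expansion (λ x → h a x * g x) coeff
        degree  : DegreeBound coeff (s ℕ.+ d)
        leading : 0# ≤F e d → 0# ≤F coeff (s ℕ.+ d)

    expansion-mul-h : ∀ s (a : Fin s → ℕ) (g e : ℕ → Carrier) d →
      Expansion g e → DegreeBound e d → TimesH a g e d
    expansion-mul-h zero a g e d ex dg = record
      { coeff = e ; expands = expansion-cong e ex (λ i _ → *-identityˡ (g i))
      ; degree = dg ; leading = λ p → p }
    expansion-mul-h (suc s) a g e d ex dg = record
      { coeff   = mulLinear (fromℕ (a fzero)) coeff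
      ; expands = expansion-cong _ (expansion-mulLinear (a fzero) _ coeff expands) (λ i _ → *-assoc _ _ _)
      ; degree  = degree-mulLinear _ coeff (s ℕ.+ d) degree
      ; leading = λ p → leading-mulLinear _ coeff (s ℕ.+ d) degree (leading p) }
      where open TimesH (expansion-mul-h s (λ k → a (fsuc k)) g e d ex dg)

  Π-zero : ∀ {s} (f : Fin s → Carrier) k → f k ≈ 0# → Π f ≈ 0#
  Π-zero f fzero e = trans (*-congʳ e) (zeroˡ _)
  Π-zero f (fsuc k) e = trans (*-congˡ (Π-zero (λ k' → f (fsuc k')) k e)) (zeroʳ _)

  Π-nonneg : ∀ {s} (f : Fin s → Carrier) → (∀ k → 0# ≤F f k) → 0# ≤F Π f
  Π-nonneg {zero} f p = 0≤1
  Π-nonneg {suc s} f p = *-nonneg (p fzero) (Π-nonneg (λ k → f (fsuc k)) (λ k → p (fsuc k)))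

  hℤ : ∀ {s} → (Fin s → ℕ) → ℕ → ℤ
  hℤ {zero} a i = + 1
  hℤ {suc s} a i = ((+ a fzero) ℤ.- (+ i)) ℤ.* hℤ (λ k → a (fsuc k)) i

  fromℤ-hℤ : ∀ {s} (a : Fin s → ℕ) i → fromℤ (hℤ a i) ≈ h a i
  fromℤ-hℤ {zero} a i = fromℕ-1
  fromℤ-hℤ {suc s} a i =
    trans (fromℤ-* ((+ a fzero) ℤ.- (+ i)) (hℤ (λ k → a (fsuc k)) i))
          (*-cong (trans (fromℤ-+ (+ a fzero) (ℤ.- (+ i))) (+-congˡ (fromℤ-neg (+ i))))
                  (fromℤ-hℤ (λ k → a (fsuc k)) i))

  module Quasicode (u n : ℕ) (u≥1 : 1 ℕ.≤ u) (A : ℕ → Carrier) (N : Carrier)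
                   (qc : IsQuasicode (suc u) n A N) where
    open KExpansion u n u≥1
    open IsQuasicode qc

    N≥1 : 1# ≤F N
    N≥1 = ≤F-respʳ size (≤F-respˡ A₀≈1
            (Σ-≥term (suc n) 0 (s≤s z≤n) (λ i i<n → nonneg i (ℕP.≤-pred i<n))))

    N≉0 : ¬ (N ≈ 0#)
    N≉0 e = 0≉1 (sym (antisym (≤F-respʳ e N≥1) 0≤1))

    dualSum : ℕ → Carrier
    dualSum l = Σ< (λ i → A i * Kn l i) (suc n)

    dualSum₀ : dualSum 0 ≈ N
    dualSum₀ = trans (Σ-cong′ (suc n) (λ i → trans (*-congˡ (K₀≈1 i)) (*-identityʳ _))) size

    -- A t-design integrates every g of K-degree ≤ t to N times its
    -- constant coefficient: Σ_i A_i g(i) = Σ_l e_l N A⊥_l = N e_0.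
    design-integrates : ∀ t → IsDesign (suc u) n A N t →
      ∀ g e d → Expansion g e → DegreeBound e d → d ℕ.≤ t →
      Σ< (λ i → A i * g i) (suc n) ≈ N * e 0
    design-integrates t des g e d ex dg d≤t = begin
      Σ< (λ i → A i * g i) (suc n)
        ≈⟨ Σ-cong (suc n) (λ i i<n → *-congˡ (ex i (ℕP.≤-pred i<n))) ⟩
      Σ< (λ i → A i * Σ< (λ l → e l * Kn l i) (suc n)) (suc n)
        ≈⟨ Σ-cong′ (suc n) (λ i → trans (sym (Σ-*ˡ (A i) _ (suc n)))
             (Σ-cong′ (suc n) (λ l → solve 3 (λ A' E K' → A' :* (E :* K') := E :* (A' :* K')) refl (A i) (e l) (Kn l i)))) ⟩
      Σ< (λ i → Σ< (λ l → e l * (A i * Kn l i)) (suc n)) (suc n) ≈⟨ Σ-swap _ (suc n) (suc n) ⟩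
      Σ< (λ l → Σ< (λ i → e l * (A i * Kn l i)) (suc n)) (suc n) ≈⟨ Σ-cong′ (suc n) (λ l → Σ-*ˡ (e l) _ (suc n)) ⟩
      Σ< (λ l → e l * dualSum l) (suc n) ≈⟨ Σ-delta (suc n) 0 (s≤s z≤n) higher-terms ⟩
      e 0 * dualSum 0 ≈⟨ trans (*-congˡ dualSum₀) (*-comm _ _) ⟩
      N * e 0 ∎
      where
      dualSum-vanishes : ∀ l → 1 ℕ.≤ l → l ℕ.≤ t → l ℕ.≤ n → dualSum l ≈ 0#
      dualSum-vanishes l 1≤l l≤t l≤n = begin
        dualSum l ≈⟨ sym (*-identityˡ _) ⟩
        1# * dualSum l ≈⟨ *-congʳ (sym (inv-r N≉0)) ⟩
        (N * N ⁻¹) * dualSum l ≈⟨ *-assoc _ _ _ ⟩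
        N * (N ⁻¹ * dualSum l) ≈⟨ *-congˡ (des l 1≤l l≤t l≤n) ⟩
        N * 0# ≈⟨ zeroʳ N ⟩
        0# ∎
      higher-terms : ∀ l → l ℕ.< suc n → ¬ (l ≡ 0) → e l * dualSum l ≈ 0#
      higher-terms zero _ l≢0 = ⊥-elim (l≢0 P.refl)
      higher-terms (suc l) l<n _ with ℕP.≤-<-connex (suc l) t
      ... | inj₁ l≤t = trans (*-congˡ (dualSum-vanishes (suc l) (s≤s z≤n) l≤t (ℕP.≤-pred l<n))) (zeroʳ _)
      ... | inj₂ t<l = trans (*-congʳ (dg (suc l) (ℕP.≤-<-trans d≤t t<l))) (zeroˡ _)

    module Annihilator {s} (a : Fin s → ℕ) (sup : IsSupport n A a) where

      -- h kills every term A_i h(i) f(i) with 1 ≤ i ≤ n: either i = a_k and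
      -- h(i) = 0, or i is outside the support and A_i ≈ 0 cannot be refuted.
      support-annihilated : ∀ (f : ℕ → Carrier) i → 1 ℕ.≤ i → i ℕ.≤ n → ¬ ¬ (A i * (h a i * f i) ≈ 0#)
      support-annihilated f i 1≤i i≤n with any? (λ k → a k ℕ.≟ i)
      ... | yes (k , aₖ≡i) = λ nz → nz (trans (*-congˡ h-zero) (zeroʳ _))
        where
        factor-zero : fromℕ (a k) - fromℕ i ≈ 0#
        factor-zero = trans (+-congʳ (fromℕ-cong aₖ≡i)) (-‿inverseʳ _)
        h-zero : h a i * f i ≈ 0#
        h-zero = trans (*-congʳ (Π-zero (λ k → fromℕ (a k) - fromℕ i) k factor-zero)) (zeroˡ _)
      ... | no ∉a = λ nz → ∉a (Equivalence.to (sup i) (1≤i , i≤n , (λ e → nz (trans (*-congʳ e) (zeroˡ _)))))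

      h-at-0-nonneg : 0# ≤F h a 0
      h-at-0-nonneg = Π-nonneg (λ k → fromℕ (a k) - fromℕ 0)
        (λ k → ≤F-respʳ (sym (trans (+-congˡ -0#≈0#) (+-identityʳ _))) (fromℕ≥0 (a k)))

      inner-h-K-integral : ∀ j → ∃ λ z → fromℤ z ≈ inner (h a) (Kn j)
      inner-h-K-integral j =
        sumℤ (λ i → (+ ((n C i) ℕ.* u ℕ.^ i)) ℤ.* (hℤ a i ℤ.* Krawtchouk (suc u) n j i)) (suc n) ,
        trans (fromℤ-Σ _ (suc n)) (Σ-cong′ (suc n) (λ i →
          trans (fromℤ-* (+ ((n C i) ℕ.* u ℕ.^ i)) (hℤ a i ℤ.* Krawtchouk (suc u) n j i))
                (*-congˡ (trans (fromℤ-* (hℤ a i) (Krawtchouk (suc u) n j i)) (*-congʳ (fromℤ-hℤ a i))))))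

      -- For j < s the product h K_j has K-degree s + j ≤ 2s - 1, so a
      -- (2s-1)-design integrates it to N ĝ₀; by the vanishing on the support
      -- that integral is A_0 h(0) K_j(0) ≥ 0, and ⟨h,K_j⟩ = ĝ₀ ⟨K_0,K_0⟩.
      inner-h-K-nonneg : IsDesign (suc u) n A N (2 ℕ.* s ℕ.∸ 1) →
        ∀ j → j ℕ.< s → j ℕ.≤ n → 0# ≤F inner (h a) (Kn j)
      inner-h-K-nonneg des j j<s j≤n =
        integral-nonneg (proj₁ (inner-h-K-integral j)) (proj₂ (inner-h-K-integral j))
          (λ neg → constant-nonneg (λ ĝ₀≥0 → neg (≤F-respʳ inner-as-constant (*-nonneg ĝ₀≥0 (normSq≥0 0)))))
        where
        open TimesH (expansion-mul-h s a (Kn j) (unit j) j (expansion-K j j≤n) (degree-unit j))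
        g : ℕ → Carrier
        g x = h a x * Kn j x
        s+j≤2s-1 : s ℕ.+ j ℕ.≤ 2 ℕ.* s ℕ.∸ 1
        s+j≤2s-1 = ℕP.<⇒≤pred (P.subst (λ z → s ℕ.+ j ℕ.< s ℕ.+ z) (P.sym (ℕP.+-identityʳ s)) (ℕP.+-monoʳ-< s j<s))
        integral : Σ< (λ i → A i * g i) (suc n) ≈ N * coeff 0
        integral = design-integrates (2 ℕ.* s ℕ.∸ 1) des g coeff (s ℕ.+ j) expands degree s+j≤2s-1
        A₀g₀≥0 : 0# ≤F A 0 * g 0
        A₀g₀≥0 = *-nonneg (nonneg 0 z≤n) (*-nonneg h-at-0-nonneg (K-at-0-nonneg j))
        constant-nonneg : ¬ ¬ (0# ≤F coeff 0)
        constant-nonneg k = Σ-¬¬-single (λ i → A i * g i) n (support-annihilated (Kn j))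
          (λ sum≈A₀g₀ → k (nonneg-cancel (≤F-trans 0≤1 N≥1) N≉0 (≤F-respʳ (trans (sym sum≈A₀g₀) integral) A₀g₀≥0)))
        inner-as-constant : coeff 0 * normSq 0 ≈ inner (h a) (Kn j)
        inner-as-constant = trans (sym (inner-with-K g coeff expands 0 z≤n))
          (Σ-cong′ (suc n) (λ i → *-congˡ (trans (*-congˡ (K₀≈1 i)) (*-identityʳ _))))

      h-expansion : TimesH a (Kn 0) (unit 0) 0
      h-expansion = expansion-mul-h s a (Kn 0) (unit 0) 0 (expansion-K 0 z≤n) (degree-unit 0)

      -- The K-coefficients of h are ⟨h,K_j⟩/⟨K_j,K_j⟩ ≥ 0 for j < s, the top
      -- coefficient for j = s, and 0 for j > s.
      positive-definite : IsDesign (suc u) n A N (2 ℕ.* s ℕ.∸ 1) → PositiveDefinite (suc u) n (h a)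
      positive-definite des = (coeff , expands-h) , coefficients-nonneg
        where
        open TimesH h-expansion
        expands-h : Expansion (h a) coeff
        expands-h = expansion-cong coeff expands (λ i _ → sym (trans (*-congˡ (K₀≈1 i)) (*-identityʳ _)))
        via-h-expansion : ∀ cs → Expansion (h a) cs → ∀ j → j ℕ.≤ n → cs j ≈ coeff j
        via-h-expansion cs exc j j≤n =
          trans (coefficient-formula (h a) cs exc j j≤n) (sym (coefficient-formula (h a) coeff expands-h j j≤n))
        coefficients-nonneg : ∀ cs → Expansion (h a) cs → ∀ j → j ℕ.≤ n → 0# ≤F cs j
        coefficients-nonneg cs exc j j≤n with ℕP.<-cmp j s
        ... | tri< j<s _ _ = ≤F-respʳ (sym (coefficient-formula (h a) cs exc j j≤n))
                               (*-nonneg (inv≥0 (normSq≥0 j) (normSq≉0 j j≤n)) (inner-h-K-nonneg des j j<s j≤n))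
        ... | tri≈ _ P.refl _ = ≤F-respʳ (sym (via-h-expansion cs exc j j≤n))
                                  (P.subst (λ z → 0# ≤F coeff z) (ℕP.+-identityʳ s) (leading (≤F-respʳ (sym (unit-same 0)) 0≤1)))
        ... | tri> _ _ s<j = ≤F-respʳ (sym (via-h-expansion cs exc j j≤n))
                               (≈0⇒≥0 (degree j (P.subst (ℕ._< j) (P.sym (ℕP.+-identityʳ s)) s<j)))

open import Data.Nat using (_≤_; _*_; _∸_)
open OrderedField using (Carrier)
open OverField

-- Lemma 4.5: the case q = u + 2 of the development above (q ≥ 2 rules out
-- q = 0 and q = 1).
lemma4p5 : ∀ {c ℓ₁ ℓ₂} (F : OrderedField c ℓ₁ ℓ₂) →
    (q n : ℕ) → 2 ≤ q → 1 ≤ n →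
    (A : ℕ → Carrier F) (N : Carrier F) → IsQuasicode F q n A N →
    (s : ℕ) (a : Fin s → ℕ) → StrictlyIncreasing F a → IsSupport F n A a →
    IsDesign F q n A N (2 * s ∸ 1) →
    PositiveDefinite F q n (h F a)
lemma4p5 F (suc zero) n (s≤s ()) A N qc s a _ sup des
lemma4p5 F (suc (suc u)) n _ _ A N qc s a _ sup des =
  Annihilator.positive-definite a sup des
  where open OverOrderedField.Quasicode F (suc u) n (s≤s z≤n) A N qc
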